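{- Let $S(q)$ be the formal power series defined in the context, and write $\Delta^{(\ell)}_n=\Delta^{(\ell)}_n(S)$. (1) For each $\ell\in\{0,1,2,3\}$ the sequence $(\Delta^{(\ell)}_n)_{n\ge0}$ is $12$-periodic, $\Delta^{(\ell)}_{n+12}=\Delta^{(\ell)}_n$, and consists only of $-1,0,1$. The first twelve terms ($n=0,\dots,11$) are: $\Delta^{(0)}_n:\ 1,1,-1,-1,1,0,-1,0,0,1,0,-1$; $\Delta^{(1)}_n:\ 1,1,0,-1,0,0,-1,0,1,1,-1,-1$; $\Delta^{(2)}_n:\ 1,0,0,-1,0,1,-1,-1,1,1,-1,0$; $\Delta^{(3)}_n:\ 1,0,-1,-1,1,1,-1,-1,0,1,0,0$. (2) For $\ell=0,1,2$ and all $n\ge0$: $\Delta^{(\ell+1)}_n=(-1)^{n-1}\Delta^{(\ell)}_{n+3}$.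
   Context: $S(q)\in\mathbb{Z}[[q]]$ is the Taylor expansion at $q=0$ of $\frac{q^3+2q-1+\sqrt{(1-q+q^2)(1+q+4q^2+q^3+q^4)}}{2q}$ (square-root branch equal to $1$ at $q=0$); equivalently, the unique formal power series satisfying $q\,S(q)^2+(1-2q-q^3)S(q)=1$. It begins $S(q)=1+q+q^4-2q^6+q^7+4q^8-\cdots$ (it is the $q$-deformation of the silver ratio $1+\sqrt2$). For a power series $f=\sum_{i\ge0}f_iq^i$ and integers $\ell,n\ge 0$, $\Delta^{(\ell)}_n(f)$ is the determinant of the $n\times n$ matrix $(f_{\ell+i+j})_{0\le i,j\le n-1}$, with $\Delta^{(\ell)}_0(f)=1$. -}

module Defs where

open import Data.Nat using (ℕ; zero; suc)
open import Data.Integer using (ℤ; +_; -_; _+_; _-_; _*_; -1ℤ; 0ℤ; 1ℤ)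
open import Data.Fin using (Fin; zero; suc; toℕ; punchIn)
open import Data.Product using (_×_)
open import Relation.Binary.PropositionalEquality using (_≡_)

Series : Set
Series = ℕ → ℤ

shiftQ : Series → Series
shiftQ f zero    = 0ℤ
shiftQ f (suc n) = f n

sumUpTo : ℕ → (ℕ → ℤ) → ℤ
sumUpTo zero    g = g zero
sumUpTo (suc m) g = sumUpTo m g + g (suc m)

sub : ℕ → ℕ → ℕ
sub m zero = m
sub zero (suc n) = zero
sub (suc m) (suc n) = sub m n

mulS : Series → Series → Series
mulS f g m = sumUpTo m (λ i → f i * g (sub m i))

addS : Series → Series → Series
addS f g n = f n + g n

negS : Series → Series
negS f n = - f n

oneS : Series
oneS zero    = 1ℤ
oneS (suc n) = 0ℤ

-- f satisfies  q f^2 + (1 - 2q - q^3) f = 1  (coefficientwise)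
SilverEq : Series → Set
SilverEq f = ∀ n →
  addS (shiftQ (mulS f f))
       (addS f (negS (addS (shiftQ f) (addS (shiftQ f) (shiftQ (shiftQ (shiftQ f))))))) n
  ≡ oneS n

signPow : ℕ → ℤ
signPow zero    = 1ℤ
signPow (suc k) = - signPow k

sumFin : (n : ℕ) → (Fin n → ℤ) → ℤ
sumFin zero    g = 0ℤ
sumFin (suc n) g = g zero + sumFin n (λ j → g (suc j))

det : (n : ℕ) → (Fin n → Fin n → ℤ) → ℤ
det zero    M = 1ℤ
det (suc n) M = sumFin (suc n) (λ j →
  signPow (toℕ j) * (M zero j * det n (λ i k → M (suc i) (punchIn j k))))

hankel : Series → ℕ → (n : ℕ) → ℤ
hankel f ℓ n = det n (λ i j → f (ℓ Data.Nat.+ toℕ i Data.Nat.+ toℕ j))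

IsSign : ℤ → Set
IsSign x = (x ≡ -1ℤ) Data.Sum.⊎ ((x ≡ 0ℤ) Data.Sum.⊎ (x ≡ 1ℤ))
  where import Data.Sum

open import Data.Vec using (Vec; []; _∷_; lookup)

table : Fin 4 → Vec ℤ 12
table zero = 1ℤ ∷ 1ℤ ∷ -1ℤ ∷ -1ℤ ∷ 1ℤ ∷ 0ℤ ∷ -1ℤ ∷ 0ℤ ∷ 0ℤ ∷ 1ℤ ∷ 0ℤ ∷ -1ℤ ∷ []
table (suc zero) = 1ℤ ∷ 1ℤ ∷ 0ℤ ∷ -1ℤ ∷ 0ℤ ∷ 0ℤ ∷ -1ℤ ∷ 0ℤ ∷ 1ℤ ∷ 1ℤ ∷ -1ℤ ∷ -1ℤ ∷ []
table (suc (suc zero)) = 1ℤ ∷ 0ℤ ∷ 0ℤ ∷ -1ℤ ∷ 0ℤ ∷ 1ℤ ∷ -1ℤ ∷ -1ℤ ∷ 1ℤ ∷ 1ℤ ∷ -1ℤ ∷ 0ℤ ∷ []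
table (suc (suc (suc zero))) = 1ℤ ∷ 0ℤ ∷ -1ℤ ∷ -1ℤ ∷ 1ℤ ∷ 1ℤ ∷ -1ℤ ∷ -1ℤ ∷ 0ℤ ∷ 1ℤ ∷ 0ℤ ∷ 0ℤ ∷ []

-- By Han's theory of Hankel continued fractions, if D(0) = 1 and D · F = q^k, then
-- Δ_n(F) = 0 for 1 ≤ n ≤ k and Δ_{k+1+m}(F) = ε_k Δ_m(G), where G = -(D - (terms of degree ≤ k+1)) / q^(k+2);
-- this comes from column operations on the Hankel matrix of F.  Put G₀ = -S and G_j = (A_j - S) / (q^(e_j) C_j)
-- for suitable polynomials A_j and units C_j ∈ {1, 1 + q², 1 - q + q²}.  The quadratic equation of S gives
-- ±G_j = q^(k_j) / (p_j - q^(k_j + 2) G_(j+1)) with G₉ = G₁, so the H-fraction of S is eventually periodic, with a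
-- cycle of eight steps whose shifts k_j + 1 add up to 12.  The Hankel determinants of the G_j are therefore determined
-- by a recursion, which explicit 12-periodic sequences also satisfy.  Finally (S - (terms of degree < ℓ)) / q^ℓ is
-- -G₃, -G₅, -G₆ for ℓ = 1, 2, 3, so that Δ^(ℓ)_n(S) = (-1)^n Δ_n(G) for the corresponding G.

module Submission where

open import Data.Nat as ℕ using (ℕ; zero; suc; _<_; _≤_; z≤n; s≤s; _∸_; _≟_; _<?_)
import Data.Nat.Properties as ℕ
open import Data.Nat.DivMod using (_mod_; _%_; [m+n]%n≡m%n; m<n⇒m%n≡m)
open import Data.Nat.Induction using (<-rec)
open import Data.Integer as ℤ using (ℤ; -_; _-_; _*_; 0ℤ; 1ℤ; -1ℤ)
import Data.Integer.Properties as ℤ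
open import Data.Integer.Solver using (module +-*-Solver)
open import Data.Fin as Fin using (Fin; toℕ; fromℕ<; inject₁)
import Data.Fin.Properties as Fin
open import Data.List using (List; []; _∷_; length)
open import Data.Vec using (Vec; []; _∷_; head; toList; lookup)
open import Data.Vec.Properties using (length-toList)
open import Data.Bool using (Bool; true; false; if_then_else_)
open import Data.Product using (_×_; _,_; _,′_; proj₁; proj₂)
open import Data.Sum using (inj₁; inj₂)
open import Data.Maybe using (Maybe; just; nothing)
open import Data.Empty using (⊥-elim)
open import Function using (_∘_; case_of_)
open import Relation.Nullary using (yes; no)
open import Relation.Nullary.Decidable using (Dec; from-yes; _×-dec_; _⊎-dec_)
open import Relation.Binary using (tri<; tri≈; tri>)
open import Relation.Binary.PropositionalEquality
open import Algebra.Bundles using (CommutativeRing)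
open import Algebra.Solver.Ring.AlmostCommutativeRing using (AlmostCommutativeRing; fromCommutativeRing; _-Raw-AlmostCommutative⟶_)
import Algebra.Construct.Pointwise ℕ as Pointwise
import Algebra.Solver.Ring
open import Defs
open import Algebra.Structures {A = Series} _≗_ using (IsCommutativeRing)

module FiniteSums where

  open import Data.Integer using (_+_)
  open +-*-Solver using (solve; _:=_; _:+_)

  ∑< : ℕ → (ℕ → ℤ) → ℤ
  ∑< zero    f = 0ℤ
  ∑< (suc n) f = f 0 + ∑< n (λ i → f (suc i))

  syntax ∑< n (λ i → e) = ∑[ i < n ] e

  ∑-cong : ∀ n {f g : ℕ → ℤ} → (∀ i → i < n → f i ≡ g i) → ∑< n f ≡ ∑< n g
  ∑-cong zero    f≡g = refl
  ∑-cong (suc n) f≡g = cong₂ _+_ (f≡g 0 (s≤s z≤n)) (∑-cong n (λ i i<n → f≡g (suc i) (s≤s i<n)))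

  ∑-zero : ∀ n {f : ℕ → ℤ} → (∀ i → i < n → f i ≡ 0ℤ) → ∑< n f ≡ 0ℤ
  ∑-zero zero    f≡0 = refl
  ∑-zero (suc n) f≡0 = cong₂ _+_ (f≡0 0 (s≤s z≤n)) (∑-zero n (λ i i<n → f≡0 (suc i) (s≤s i<n)))

  ∑-distrib-+ : ∀ n (f g : ℕ → ℤ) → ∑[ i < n ] (f i + g i) ≡ ∑< n f + ∑< n g
  ∑-distrib-+ zero    f g = refl
  ∑-distrib-+ (suc n) f g
    rewrite ∑-distrib-+ n (λ i → f (suc i)) (λ i → g (suc i)) =
      solve 4 (λ a b c d → (a :+ b) :+ (c :+ d) := (a :+ c) :+ (b :+ d)) refl
        (f 0) (g 0) (∑< n (λ i → f (suc i))) (∑< n (λ i → g (suc i)))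

  *-distribˡ-∑ : ∀ n c (f : ℕ → ℤ) → c * ∑< n f ≡ ∑[ i < n ] (c * f i)
  *-distribˡ-∑ zero    c f = ℤ.*-zeroʳ c
  *-distribˡ-∑ (suc n) c f =
    trans (ℤ.*-distribˡ-+ c (f 0) _) (cong (c * f 0 +_) (*-distribˡ-∑ n c (λ i → f (suc i))))

  neg-distrib-∑ : ∀ n (f : ℕ → ℤ) → - ∑< n f ≡ ∑[ i < n ] (- f i)
  neg-distrib-∑ zero    f = refl
  neg-distrib-∑ (suc n) f =
    trans (ℤ.neg-distrib-+ (f 0) _) (cong (- f 0 +_) (neg-distrib-∑ n (λ i → f (suc i))))

  ∑-init-last : ∀ n (f : ℕ → ℤ) → ∑< (suc n) f ≡ ∑< n f + f n
  ∑-init-last zero    f = trans (ℤ.+-identityʳ (f 0)) (sym (ℤ.+-identityˡ (f 0)))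
  ∑-init-last (suc n) f rewrite ∑-init-last n (λ i → f (suc i)) = sym (ℤ.+-assoc (f 0) _ _)

  ∑-comm : ∀ m n (f : ℕ → ℕ → ℤ) → ∑[ i < m ] ∑[ j < n ] f i j ≡ ∑[ j < n ] ∑[ i < m ] f i j
  ∑-comm zero    n f = sym (∑-zero n (λ _ _ → refl))
  ∑-comm (suc m) n f rewrite ∑-comm m n (λ i j → f (suc i) j) =
    sym (∑-distrib-+ n (f 0) (λ j → ∑[ i < m ] f (suc i) j))

  ∑-split : ∀ m n (f : ℕ → ℤ) → ∑< (m ℕ.+ n) f ≡ ∑< m f + ∑[ i < n ] f (m ℕ.+ i)
  ∑-split zero    n f = sym (ℤ.+-identityˡ _)
  ∑-split (suc m) n f rewrite ∑-split m n (λ i → f (suc i)) = sym (ℤ.+-assoc (f 0) _ _)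

  ∑-single : ∀ n c (f : ℕ → ℤ) → c < n → (∀ i → i < n → i ≢ c → f i ≡ 0ℤ) → ∑< n f ≡ f c
  ∑-single (suc n) zero f _ others
    rewrite ∑-zero n (λ i i<n → others (suc i) (s≤s i<n) λ ()) = ℤ.+-identityʳ (f 0)
  ∑-single (suc n) (suc c) f (s≤s c<n) others
    rewrite others 0 (s≤s z≤n) (λ ())
          | ∑-single n c (λ i → f (suc i)) c<n
              (λ i i<n i≢c → others (suc i) (s≤s i<n) (i≢c ∘ ℕ.suc-injective)) = ℤ.+-identityˡ _

  ∑-cancel-adjacent : ∀ n t (f : ℕ → ℤ) → suc t < n →
    (∀ i → i < n → i ≢ t → i ≢ suc t → f i ≡ 0ℤ) → f t + f (suc t) ≡ 0ℤ → ∑< n f ≡ 0ℤ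
  ∑-cancel-adjacent (suc (suc n)) zero f _ others cancel
    rewrite ∑-zero n (λ i i<n → others (suc (suc i)) (s≤s (s≤s i<n)) (λ ()) (λ ()))
          | ℤ.+-identityʳ (f 1) = cancel
  ∑-cancel-adjacent (suc n) (suc t) f (s≤s t<n) others cancel
    rewrite others 0 (s≤s z≤n) (λ ()) (λ ())
          | ∑-cancel-adjacent n t (λ i → f (suc i)) t<n
              (λ i i<n i≢t i≢st → others (suc i) (s≤s i<n) (i≢t ∘ ℕ.suc-injective) (i≢st ∘ ℕ.suc-injective))
              cancel = refl

  ∑-reverse : ∀ n (f : ℕ → ℤ) → ∑< n f ≡ ∑[ i < n ] f (n ∸ suc i)
  ∑-reverse zero    f = refl
  ∑-reverse (suc n) f = begin
    f 0 + ∑[ i < n ] f (suc i)              ≡⟨ cong (f 0 +_) (∑-reverse n (λ i → f (suc i))) ⟩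
    f 0 + ∑[ i < n ] f (suc (n ∸ suc i))    ≡⟨ ℤ.+-comm (f 0) _ ⟩
    ∑[ i < n ] f (suc (n ∸ suc i)) + f 0    ≡⟨ cong₂ _+_ (∑-cong n (λ i i<n → cong f (sym (ℕ.+-∸-assoc 1 i<n))))
                                                         (cong f (sym (ℕ.n∸n≡0 n))) ⟩
    ∑[ i < n ] f (n ∸ i) + f (n ∸ n)        ≡⟨ sym (∑-init-last n (λ i → f (n ∸ i))) ⟩
    ∑[ i < suc n ] f (n ∸ i)                ∎
    where open ≡-Reasoning

open FiniteSums

module Determinants where

  open import Data.Integer using (_+_)
  open +-*-Solver using (solve; _:=_; _:+_; _:*_; :-_; _:-_; con)

  -- Matrices are total functions on ℕ × ℕ; det′ n M is the determinant of the leading n × n block,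
  -- expanded along the first row like Defs.det (see det≡det′).
  Matrix : Set
  Matrix = ℕ → ℕ → ℤ

  punchInℕ : ℕ → ℕ → ℕ
  punchInℕ zero    b       = suc b
  punchInℕ (suc c) zero    = zero
  punchInℕ (suc c) (suc b) = suc (punchInℕ c b)

  punchOutℕ : ℕ → ℕ → ℕ
  punchOutℕ zero    r       = ℕ.pred r
  punchOutℕ (suc c) zero    = zero
  punchOutℕ (suc c) (suc r) = suc (punchOutℕ c r)

  punchInℕ-≤ : ∀ c b → punchInℕ c b ≤ suc b
  punchInℕ-≤ zero    b       = ℕ.≤-refl
  punchInℕ-≤ (suc c) zero    = z≤n
  punchInℕ-≤ (suc c) (suc b) = s≤s (punchInℕ-≤ c b)

  punchInℕ-< : ∀ {c b} → b < c → punchInℕ c b ≡ b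
  punchInℕ-< {suc c} {zero}  _         = refl
  punchInℕ-< {suc c} {suc b} (s≤s b<c) = cong suc (punchInℕ-< b<c)

  punchInℕ-≥ : ∀ {c b} → c ≤ b → punchInℕ c b ≡ suc b
  punchInℕ-≥ {zero}  {b}     _         = refl
  punchInℕ-≥ {suc c} {suc b} (s≤s c≤b) = cong suc (punchInℕ-≥ c≤b)

  punchInℕ-injective : ∀ c b b′ → punchInℕ c b ≡ punchInℕ c b′ → b ≡ b′
  punchInℕ-injective zero    b       b′       eq = ℕ.suc-injective eq
  punchInℕ-injective (suc c) zero    zero     eq = refl
  punchInℕ-injective (suc c) (suc b) (suc b′) eq =
    cong suc (punchInℕ-injective c b b′ (ℕ.suc-injective eq))

  punchInℕᵢ≢i : ∀ c b → punchInℕ c b ≢ c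
  punchInℕᵢ≢i zero    b       ()
  punchInℕᵢ≢i (suc c) zero    ()
  punchInℕᵢ≢i (suc c) (suc b) eq = punchInℕᵢ≢i c b (ℕ.suc-injective eq)

  punchInℕ-punchOutℕ : ∀ {c r} → r ≢ c → punchInℕ c (punchOutℕ c r) ≡ r
  punchInℕ-punchOutℕ {zero}  {zero}  r≢c = ⊥-elim (r≢c refl)
  punchInℕ-punchOutℕ {zero}  {suc r} r≢c = refl
  punchInℕ-punchOutℕ {suc c} {zero}  r≢c = refl
  punchInℕ-punchOutℕ {suc c} {suc r} r≢c = cong suc (punchInℕ-punchOutℕ (r≢c ∘ cong suc))

  punchOutℕ-< : ∀ {m c r} → c < suc m → r < suc m → r ≢ c → punchOutℕ c r < m
  punchOutℕ-< {m}     {zero}  {zero}  _         _         r≢c = ⊥-elim (r≢c refl)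
  punchOutℕ-< {m}     {zero}  {suc r} _         (s≤s r<m) r≢c = r<m
  punchOutℕ-< {zero}  {suc c} {r}     (s≤s ())  _         _
  punchOutℕ-< {suc m} {suc c} {zero}  _         _         _   = s≤s z≤n
  punchOutℕ-< {suc m} {suc c} {suc r} (s≤s c<m) (s≤s r<m) r≢c =
    s≤s (punchOutℕ-< c<m r<m (r≢c ∘ cong suc))

  punchOutℕ-suc : ∀ {c t} → c ≢ t → c ≢ suc t → punchOutℕ c (suc t) ≡ suc (punchOutℕ c t)
  punchOutℕ-suc {zero}        {zero}  c≢t _    = ⊥-elim (c≢t refl)
  punchOutℕ-suc {zero}        {suc t} _   _    = refl
  punchOutℕ-suc {suc zero}    {zero}  _   c≢st = ⊥-elim (c≢st refl)
  punchOutℕ-suc {suc (suc c)} {zero}  _   _    = refl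
  punchOutℕ-suc {suc c}       {suc t} c≢t c≢st =
    cong suc (punchOutℕ-suc (c≢t ∘ cong suc) (c≢st ∘ cong suc))

  minor : Matrix → ℕ → Matrix
  minor M c a b = M (suc a) (punchInℕ c b)

  det′ : ℕ → Matrix → ℤ
  det′ zero    M = 1ℤ
  det′ (suc n) M = ∑[ c < suc n ] (signPow c * (M 0 c * det′ n (minor M c)))

  det′-cong : ∀ n {M N : Matrix} → (∀ a b → a < n → b < n → M a b ≡ N a b) → det′ n M ≡ det′ n N
  det′-cong zero    M≡N = refl
  det′-cong (suc n) M≡N = ∑-cong (suc n) λ c c<n →
    cong₂ (λ x y → signPow c * (x * y)) (M≡N 0 c (s≤s z≤n) c<n)
      (det′-cong n (λ a b a<n b<n →
        M≡N (suc a) (punchInℕ c b) (s≤s a<n) (ℕ.≤-trans (s≤s (punchInℕ-≤ c b)) (s≤s b<n))))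

  det′-cong-≗ : ∀ n {M N : Matrix} → (∀ a b → M a b ≡ N a b) → det′ n M ≡ det′ n N
  det′-cong-≗ n M≡N = det′-cong n (λ a b _ _ → M≡N a b)

  -- Expand every minor along its first column and exchange the two sums.
  det′-expand-firstColumn : ∀ n M →
    det′ (suc n) M ≡ ∑[ r < suc n ] (signPow r * (M r 0 * det′ n (λ a b → M (punchInℕ r a) (suc b))))
  det′-expand-firstColumn zero    M = refl
  det′-expand-firstColumn (suc m) M = cong (signPow 0 * (M 0 0 * det′ (suc m) (minor M 0)) +_) (begin
    ∑[ c < suc m ] (signPow (suc c) * (A c * det′ (suc m) (minor M (suc c))))
      ≡⟨ ∑-cong (suc m) (λ c _ → cong (λ x → signPow (suc c) * (A c * x))
           (det′-expand-firstColumn m (minor M (suc c)))) ⟩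
    ∑[ c < suc m ] (signPow (suc c) * (A c * ∑[ r < suc m ] (signPow r * (B r * X r c))))
      ≡⟨ ∑-cong (suc m) (λ c _ → distribute (signPow (suc c)) (A c) (λ r → signPow r * (B r * X r c))) ⟩
    ∑[ c < suc m ] ∑[ r < suc m ] (signPow (suc c) * (A c * (signPow r * (B r * X r c))))
      ≡⟨ ∑-comm (suc m) (suc m) (λ c r → signPow (suc c) * (A c * (signPow r * (B r * X r c)))) ⟩
    ∑[ r < suc m ] ∑[ c < suc m ] (signPow (suc c) * (A c * (signPow r * (B r * X r c))))
      ≡⟨ ∑-cong (suc m) (λ r _ → ∑-cong (suc m) (λ c _ →
           solve 5 (λ sc sr a b x → (:- sc) :* (a :* (sr :* (b :* x))) := (:- sr) :* (b :* (sc :* (a :* x))))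
             refl (signPow c) (signPow r) (A c) (B r) (X r c))) ⟩
    ∑[ r < suc m ] ∑[ c < suc m ] (signPow (suc r) * (B r * (signPow c * (A c * X r c))))
      ≡⟨ ∑-cong (suc m) (λ r _ → sym (distribute (signPow (suc r)) (B r) (λ c → signPow c * (A c * X r c)))) ⟩
    ∑[ r < suc m ] (signPow (suc r) * (B r * ∑[ c < suc m ] (signPow c * (A c * X r c)))) ∎)
    where
    open ≡-Reasoning
    A B : ℕ → ℤ
    A c = M 0 (suc c)
    B r = M (suc r) 0
    X : ℕ → ℕ → ℤ
    X r c = det′ m (λ a b → M (suc (punchInℕ r a)) (suc (punchInℕ c b)))
    distribute : ∀ s x (f : ℕ → ℤ) → s * (x * ∑< (suc m) f) ≡ ∑[ r < suc m ] (s * (x * f r))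
    distribute s x f = trans (cong (s *_) (*-distribˡ-∑ (suc m) x f)) (*-distribˡ-∑ (suc m) s (λ r → x * f r))

  det′-transpose : ∀ n M → det′ n M ≡ det′ n (λ a b → M b a)
  det′-transpose zero    M = refl
  det′-transpose (suc n) M = trans (det′-expand-firstColumn n M) (∑-cong (suc n) λ r _ →
    cong (λ x → signPow r * (M r 0 * x)) (det′-transpose n (λ a b → M (punchInℕ r a) (suc b))))

  det′-neg : ∀ n M → det′ n (λ a b → - M a b) ≡ signPow n * det′ n M
  det′-neg zero    M = refl
  det′-neg (suc n) M = trans
    (∑-cong (suc n) λ c _ → trans (cong (λ x → signPow c * (- M 0 c * x)) (det′-neg n (minor M c)))
      (solve 4 (λ sc m sn d → sc :* ((:- m) :* (sn :* d)) := (:- sn) :* (sc :* (m :* d))) refl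
        (signPow c) (M 0 c) (signPow n) (det′ n (minor M c))))
    (sym (*-distribˡ-∑ (suc n) (signPow (suc n)) (λ c → signPow c * (M 0 c * det′ n (minor M c)))))

  det′-zero-firstRow : ∀ n M → (∀ b → b < suc n → M 0 b ≡ 0ℤ) → det′ (suc n) M ≡ 0ℤ
  det′-zero-firstRow n M row0 = ∑-zero (suc n) λ c c<n →
    trans (cong (λ x → signPow c * (x * det′ n (minor M c))) (row0 c c<n))
      (trans (cong (signPow c *_) (ℤ.*-zeroˡ (det′ n (minor M c)))) (ℤ.*-zeroʳ (signPow c)))

  det′-linear-column : ∀ n r → r < n → (M N K : Matrix) (x : ℤ) →
    (∀ a j → j ≢ r → M a j ≡ N a j) → (∀ a j → j ≢ r → K a j ≡ N a j) →
    (∀ a → M a r ≡ N a r + x * K a r) → det′ n M ≡ det′ n N + x * det′ n K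
  det′-linear-column (suc m) r r<n M N K x M≡N K≡N column-r = begin
    det′ (suc m) M
      ≡⟨ ∑-cong (suc m) term ⟩
    ∑[ c < suc m ] (expansionTerm N c + x * expansionTerm K c)
      ≡⟨ ∑-distrib-+ (suc m) (expansionTerm N) (λ c → x * expansionTerm K c) ⟩
    det′ (suc m) N + ∑[ c < suc m ] (x * expansionTerm K c)
      ≡⟨ cong (det′ (suc m) N +_) (sym (*-distribˡ-∑ (suc m) x (expansionTerm K))) ⟩
    det′ (suc m) N + x * det′ (suc m) K ∎
    where
    open ≡-Reasoning
    expansionTerm : Matrix → ℕ → ℤ
    expansionTerm L c = signPow c * (L 0 c * det′ m (minor L c))
    term : ∀ c → c < suc m → expansionTerm M c ≡ expansionTerm N c + x * expansionTerm K c
    term c c<n with c ≟ r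
    ... | yes refl = begin
      signPow c * (M 0 c * det′ m (minor M c))
        ≡⟨ cong₂ (λ u v → signPow c * (u * v)) (column-r 0) (same M≡N) ⟩
      signPow c * ((N 0 c + x * K 0 c) * det′ m (minor N c))
        ≡⟨ solve 5 (λ s n x k d → s :* ((n :+ x :* k) :* d) := s :* (n :* d) :+ x :* (s :* (k :* d)))
             refl (signPow c) (N 0 c) x (K 0 c) (det′ m (minor N c)) ⟩
      expansionTerm N c + x * (signPow c * (K 0 c * det′ m (minor N c)))
        ≡⟨ cong (λ v → expansionTerm N c + x * (signPow c * (K 0 c * v))) (sym (same K≡N)) ⟩
      expansionTerm N c + x * expansionTerm K c ∎
      where
      same : ∀ {L} → (∀ a j → j ≢ r → L a j ≡ N a j) → det′ m (minor L c) ≡ det′ m (minor N c)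
      same L≡N = det′-cong-≗ m (λ a b → L≡N (suc a) (punchInℕ c b) (punchInℕᵢ≢i c b))
    ... | no c≢r = begin
      signPow c * (M 0 c * det′ m (minor M c))
        ≡⟨ cong₂ (λ u v → signPow c * (u * v)) (M≡N 0 c c≢r) minorLinear ⟩
      signPow c * (N 0 c * (det′ m (minor N c) + x * det′ m (minor K c)))
        ≡⟨ solve 5 (λ s n x k d → s :* (n :* (d :+ x :* k)) := s :* (n :* d) :+ x :* (s :* (n :* k)))
             refl (signPow c) (N 0 c) x (det′ m (minor K c)) (det′ m (minor N c)) ⟩
      expansionTerm N c + x * (signPow c * (N 0 c * det′ m (minor K c)))
        ≡⟨ cong (λ v → expansionTerm N c + x * (signPow c * (v * det′ m (minor K c)))) (sym (K≡N 0 c c≢r)) ⟩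
      expansionTerm N c + x * expansionTerm K c ∎
      where
      r′ = punchOutℕ c r
      r≡ : punchInℕ c r′ ≡ r
      r≡ = punchInℕ-punchOutℕ (c≢r ∘ sym)
      avoids-r : ∀ j → j ≢ r′ → punchInℕ c j ≢ r
      avoids-r j j≢r′ eq = j≢r′ (punchInℕ-injective c j r′ (trans eq (sym r≡)))
      minorLinear : det′ m (minor M c) ≡ det′ m (minor N c) + x * det′ m (minor K c)
      minorLinear = det′-linear-column m r′ (punchOutℕ-< c<n r<n (c≢r ∘ sym)) (minor M c) (minor N c) (minor K c) x
        (λ a j j≢r′ → M≡N (suc a) (punchInℕ c j) (avoids-r j j≢r′))
        (λ a j j≢r′ → K≡N (suc a) (punchInℕ c j) (avoids-r j j≢r′))
        (λ a → subst (λ z → M (suc a) z ≡ N (suc a) z + x * K (suc a) z) (sym r≡) (column-r (suc a)))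

  minor-equalAdjacentColumns : ∀ t (M : Matrix) → (∀ a → M a t ≡ M a (suc t)) →
    ∀ a b → M a (punchInℕ t b) ≡ M a (punchInℕ (suc t) b)
  minor-equalAdjacentColumns zero    M t≡st a zero    = sym (t≡st a)
  minor-equalAdjacentColumns zero    M t≡st a (suc b) = refl
  minor-equalAdjacentColumns (suc t) M t≡st a zero    = refl
  minor-equalAdjacentColumns (suc t) M t≡st a (suc b) = minor-equalAdjacentColumns t (λ a x → M a (suc x)) t≡st a b

  -- Along the first row the terms of columns t and t + 1 cancel, and every other minor again has two equal
  -- adjacent columns.
  det′-equalAdjacentColumns : ∀ n t → suc t < n → ∀ M → (∀ a → M a t ≡ M a (suc t)) → det′ n M ≡ 0ℤ
  det′-equalAdjacentColumns (suc m) t st<n M t≡st =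
    ∑-cancel-adjacent (suc m) t (λ c → signPow c * (M 0 c * det′ m (minor M c))) st<n vanishing cancelling
    where
    vanishing : ∀ c → c < suc m → c ≢ t → c ≢ suc t → signPow c * (M 0 c * det′ m (minor M c)) ≡ 0ℤ
    vanishing c c<n c≢t c≢st = begin
      signPow c * (M 0 c * det′ m (minor M c)) ≡⟨ cong (λ v → signPow c * (M 0 c * v)) minor≡0 ⟩
      signPow c * (M 0 c * 0ℤ)                 ≡⟨ cong (signPow c *_) (ℤ.*-zeroʳ (M 0 c)) ⟩
      signPow c * 0ℤ                           ≡⟨ ℤ.*-zeroʳ (signPow c) ⟩
      0ℤ ∎
      where
      open ≡-Reasoning
      t′ = punchOutℕ c t
      t≡ : punchInℕ c t′ ≡ t
      t≡ = punchInℕ-punchOutℕ (c≢t ∘ sym)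
      st≡ : punchInℕ c (suc t′) ≡ suc t
      st≡ = trans (cong (punchInℕ c) (sym (punchOutℕ-suc c≢t c≢st))) (punchInℕ-punchOutℕ (c≢st ∘ sym))
      minor≡0 : det′ m (minor M c) ≡ 0ℤ
      minor≡0 = det′-equalAdjacentColumns m t′
        (subst (_< m) (punchOutℕ-suc c≢t c≢st) (punchOutℕ-< c<n st<n (c≢st ∘ sym))) (minor M c)
        (λ a → trans (cong (M (suc a)) t≡) (trans (t≡st (suc a)) (cong (M (suc a)) (sym st≡))))
    cancelling : signPow t * (M 0 t * det′ m (minor M t))
               + signPow (suc t) * (M 0 (suc t) * det′ m (minor M (suc t))) ≡ 0ℤ
    cancelling = trans
      (cong₂ (λ u v → signPow t * (M 0 t * det′ m (minor M t)) + signPow (suc t) * (u * v)) (sym (t≡st 0))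
        (det′-cong-≗ m (λ a b → sym (minor-equalAdjacentColumns t M t≡st (suc a) b))))
      (solve 3 (λ s x d → s :* (x :* d) :+ (:- s) :* (x :* d) := con 0ℤ) refl
        (signPow t) (M 0 t) (det′ m (minor M t)))

  replaceColumn : Matrix → ℕ → (ℕ → ℤ) → Matrix
  replaceColumn M r w a j with j ≟ r
  ... | yes _ = w a
  ... | no  _ = M a j

  replaceColumn-≡ : ∀ M r w a → replaceColumn M r w a r ≡ w a
  replaceColumn-≡ M r w a with r ≟ r
  ... | yes _   = refl
  ... | no  r≢r = ⊥-elim (r≢r refl)

  replaceColumn-≢ : ∀ M r w a {j} → j ≢ r → replaceColumn M r w a j ≡ M a j
  replaceColumn-≢ M r w a {j} j≢r with j ≟ r
  ... | yes j≡r = ⊥-elim (j≢r j≡r)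
  ... | no  _   = refl

  det′-additive-column : ∀ n r → r < n → (M N K : Matrix) →
    (∀ a j → j ≢ r → M a j ≡ N a j) → (∀ a j → j ≢ r → K a j ≡ N a j) →
    (∀ a → M a r ≡ N a r + K a r) → det′ n M ≡ det′ n N + det′ n K
  det′-additive-column n r r<n M N K M≡N K≡N column-r =
    trans (det′-linear-column n r r<n M N K 1ℤ M≡N K≡N
            (λ a → trans (column-r a) (cong (N a r +_) (sym (ℤ.*-identityˡ (K a r))))))
          (cong (det′ n N +_) (ℤ.*-identityˡ (det′ n K)))

  -- The matrix with both columns replaced by their sum has determinant 0; expand it by additivity in each column.
  det′-swapAdjacentColumns : ∀ n t → suc t < n → ∀ M N →
    (∀ a j → j ≢ t → j ≢ suc t → N a j ≡ M a j) →
    (∀ a → N a t ≡ M a (suc t)) → (∀ a → N a (suc t) ≡ M a t) → det′ n N ≡ - det′ n M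
  det′-swapAdjacentColumns n t st<n M N N≡M Nt Nst = begin
    det′ n N                                   ≡⟨ solve 2 (λ m n → n := (m :+ n) :- m) refl (det′ n M) (det′ n N) ⟩
    (det′ n M + det′ n N) - det′ n M           ≡⟨ cong (_- det′ n M) (trans sum≡ sum≡0) ⟩
    0ℤ - det′ n M                              ≡⟨ ℤ.+-identityˡ _ ⟩
    - det′ n M ∎
    where
    open ≡-Reasoning
    t≢st : t ≢ suc t
    t≢st = ℕ.<⇒≢ (ℕ.n<1+n t)
    Ψ : (ℕ → ℤ) → (ℕ → ℤ) → Matrix
    Ψ x y = replaceColumn (replaceColumn M t x) (suc t) y
    Ψ-t : ∀ x y a → Ψ x y a t ≡ x a
    Ψ-t x y a = trans (replaceColumn-≢ _ (suc t) y a t≢st) (replaceColumn-≡ M t x a)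
    Ψ-st : ∀ x y a → Ψ x y a (suc t) ≡ y a
    Ψ-st x y a = replaceColumn-≡ _ (suc t) y a
    Ψ-other : ∀ x y a {j} → j ≢ t → j ≢ suc t → Ψ x y a j ≡ M a j
    Ψ-other x y a j≢t j≢st = trans (replaceColumn-≢ _ (suc t) y a j≢st) (replaceColumn-≢ M t x a j≢t)
    Ψ-off-t : ∀ x x′ y a j → j ≢ t → Ψ x y a j ≡ Ψ x′ y a j
    Ψ-off-t x x′ y a j j≢t = case j ≟ suc t of λ where
      (yes refl) → trans (Ψ-st x y a) (sym (Ψ-st x′ y a))
      (no j≢st)  → trans (Ψ-other x y a j≢t j≢st) (sym (Ψ-other x′ y a j≢t j≢st))
    Ψ-off-st : ∀ x y y′ a j → j ≢ suc t → Ψ x y a j ≡ Ψ x y′ a j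
    Ψ-off-st x y y′ a j j≢st = case j ≟ t of λ where
      (yes refl) → trans (Ψ-t x y a) (sym (Ψ-t x y′ a))
      (no j≢t)   → trans (Ψ-other x y a j≢t j≢st) (sym (Ψ-other x y′ a j≢t j≢st))
    u v w : ℕ → ℤ
    u a = M a t
    v a = M a (suc t)
    w a = u a + v a
    diagonal : ∀ x → det′ n (Ψ x x) ≡ 0ℤ
    diagonal x = det′-equalAdjacentColumns n t st<n (Ψ x x) (λ a → trans (Ψ-t x x a) (sym (Ψ-st x x a)))
    additive-t : ∀ y → det′ n (Ψ w y) ≡ det′ n (Ψ u y) + det′ n (Ψ v y)
    additive-t y = det′-additive-column n t (ℕ.<-trans (ℕ.n<1+n t) st<n) (Ψ w y) (Ψ u y) (Ψ v y)
      (λ a j → Ψ-off-t w u y a j) (λ a j → Ψ-off-t v u y a j)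
      (λ a → trans (Ψ-t w y a) (sym (cong₂ _+_ (Ψ-t u y a) (Ψ-t v y a))))
    additive-st : ∀ x → det′ n (Ψ x w) ≡ det′ n (Ψ x u) + det′ n (Ψ x v)
    additive-st x = det′-additive-column n (suc t) st<n (Ψ x w) (Ψ x u) (Ψ x v)
      (λ a j → Ψ-off-st x w u a j) (λ a j → Ψ-off-st x v u a j)
      (λ a → trans (Ψ-st x w a) (sym (cong₂ _+_ (Ψ-st x u a) (Ψ-st x v a))))
    Ψ≡M : ∀ a j → Ψ u v a j ≡ M a j
    Ψ≡M a j = case ((j ≟ t) ,′ (j ≟ suc t)) of λ where
      (yes refl , _)        → Ψ-t u v a
      (no _     , yes refl) → Ψ-st u v a
      (no j≢t   , no j≢st)  → Ψ-other u v a j≢t j≢st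
    Ψ≡N : ∀ a j → Ψ v u a j ≡ N a j
    Ψ≡N a j = case ((j ≟ t) ,′ (j ≟ suc t)) of λ where
      (yes refl , _)        → trans (Ψ-t v u a) (sym (Nt a))
      (no _     , yes refl) → trans (Ψ-st v u a) (sym (Nst a))
      (no j≢t   , no j≢st)  → trans (Ψ-other v u a j≢t j≢st) (sym (N≡M a j j≢t j≢st))
    sum≡ : det′ n M + det′ n N ≡ (det′ n (Ψ u u) + det′ n (Ψ u v)) + (det′ n (Ψ v u) + det′ n (Ψ v v))
    sum≡ = begin
      det′ n M + det′ n N
        ≡⟨ sym (cong₂ _+_ (det′-cong-≗ n Ψ≡M) (det′-cong-≗ n Ψ≡N)) ⟩
      det′ n (Ψ u v) + det′ n (Ψ v u)
        ≡⟨ solve 2 (λ a b → a :+ b := (con 0ℤ :+ a) :+ (b :+ con 0ℤ)) refl (det′ n (Ψ u v)) (det′ n (Ψ v u)) ⟩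
      (0ℤ + det′ n (Ψ u v)) + (det′ n (Ψ v u) + 0ℤ)
        ≡⟨ cong₂ (λ p q → (p + det′ n (Ψ u v)) + (det′ n (Ψ v u) + q)) (sym (diagonal u)) (sym (diagonal v)) ⟩
      (det′ n (Ψ u u) + det′ n (Ψ u v)) + (det′ n (Ψ v u) + det′ n (Ψ v v)) ∎
    sum≡0 : (det′ n (Ψ u u) + det′ n (Ψ u v)) + (det′ n (Ψ v u) + det′ n (Ψ v v)) ≡ 0ℤ
    sum≡0 = begin
      (det′ n (Ψ u u) + det′ n (Ψ u v)) + (det′ n (Ψ v u) + det′ n (Ψ v v))
        ≡⟨ sym (cong₂ _+_ (additive-st u) (additive-st v)) ⟩
      det′ n (Ψ u w) + det′ n (Ψ v w)  ≡⟨ sym (additive-t w) ⟩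
      det′ n (Ψ w w)                   ≡⟨ diagonal w ⟩
      0ℤ ∎

  -- Swapping columns r and r + 1 only changes the sign and brings the equal columns closer together.
  det′-equalColumns : ∀ n {t r} → t < r → r < n → ∀ M → (∀ a → M a t ≡ M a r) → det′ n M ≡ 0ℤ
  det′-equalColumns n {t} {suc r} t<sr sr<n M t≡sr = case t ≟ r of λ where
      (yes refl) → det′-equalAdjacentColumns n t sr<n M t≡sr
      (no t≢r)   → begin
        det′ n M          ≡⟨ sym (ℤ.neg-involutive (det′ n M)) ⟩
        - - det′ n M      ≡⟨ cong -_ (sym swapped) ⟩
        - det′ n N        ≡⟨ cong -_ (N≡0 t≢r) ⟩
        0ℤ ∎
    where
    open ≡-Reasoning
    r≢sr : r ≢ suc r
    r≢sr = ℕ.<⇒≢ (ℕ.n<1+n r)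
    N : Matrix
    N = replaceColumn (replaceColumn M r (λ a → M a (suc r))) (suc r) (λ a → M a r)
    N-r : ∀ a → N a r ≡ M a (suc r)
    N-r a = trans (replaceColumn-≢ _ (suc r) _ a r≢sr) (replaceColumn-≡ M r _ a)
    N-other : ∀ a j → j ≢ r → j ≢ suc r → N a j ≡ M a j
    N-other a j j≢r j≢sr = trans (replaceColumn-≢ _ (suc r) _ a j≢sr) (replaceColumn-≢ M r _ a j≢r)
    swapped : det′ n N ≡ - det′ n M
    swapped = det′-swapAdjacentColumns n r sr<n M N N-other N-r (λ a → replaceColumn-≡ _ (suc r) _ a)
    N≡0 : t ≢ r → det′ n N ≡ 0ℤ
    N≡0 t≢r = det′-equalColumns n t<r (ℕ.<-trans (ℕ.n<1+n r) sr<n) N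
      (λ a → trans (N-other a t t≢r t≢sr) (trans (t≡sr a) (sym (N-r a))))
      where
      t<r = ℕ.≤∧≢⇒< (ℕ.≤-pred t<sr) t≢r
      t≢sr = ℕ.<⇒≢ (ℕ.<-trans t<r (ℕ.n<1+n r))

  det′-addEarlierColumns : ∀ n r → r < n → ∀ K (c : ℕ → ℤ) (g : ℕ → ℕ) → (∀ s → s < K → g s < r) →
    ∀ M N → (∀ a j → j ≢ r → N a j ≡ M a j) →
    (∀ a → N a r ≡ M a r + ∑[ s < K ] (c s * M a (g s))) → det′ n N ≡ det′ n M
  det′-addEarlierColumns n r r<n zero c g g<r M N N≡M N-r = det′-cong-≗ n λ a j → case j ≟ r of λ where
      (yes refl) → trans (N-r a) (ℤ.+-identityʳ _)
      (no j≢r)   → N≡M a j j≢r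
  det′-addEarlierColumns n r r<n (suc K) c g g<r M N N≡M N-r = begin
    det′ n N                       ≡⟨ det′-linear-column n r r<n N N′ L (c K) N≡N′ L≡N′ N-r′ ⟩
    det′ n N′ + c K * det′ n L     ≡⟨ cong (λ v → det′ n N′ + c K * v) L≡0 ⟩
    det′ n N′ + c K * 0ℤ           ≡⟨ cong (det′ n N′ +_) (ℤ.*-zeroʳ (c K)) ⟩
    det′ n N′ + 0ℤ                 ≡⟨ ℤ.+-identityʳ _ ⟩
    det′ n N′                      ≡⟨ N′≡M ⟩
    det′ n M ∎
    where
    open ≡-Reasoning
    N′ L : Matrix
    N′ = replaceColumn M r (λ a → M a r + ∑[ s < K ] (c s * M a (g s)))
    L  = replaceColumn M r (λ a → M a (g K))
    gK<r : g K < r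
    gK<r = g<r K (ℕ.n<1+n K)
    N′≡M : det′ n N′ ≡ det′ n M
    N′≡M = det′-addEarlierColumns n r r<n K c g (λ s s<K → g<r s (ℕ.<-trans s<K (ℕ.n<1+n K))) M N′
      (λ a j j≢r → replaceColumn-≢ M r _ a j≢r) (λ a → replaceColumn-≡ M r _ a)
    N≡N′ : ∀ a j → j ≢ r → N a j ≡ N′ a j
    N≡N′ a j j≢r = trans (N≡M a j j≢r) (sym (replaceColumn-≢ M r _ a j≢r))
    L≡N′ : ∀ a j → j ≢ r → L a j ≡ N′ a j
    L≡N′ a j j≢r = trans (replaceColumn-≢ M r _ a j≢r) (sym (replaceColumn-≢ M r _ a j≢r))
    N-r′ : ∀ a → N a r ≡ N′ a r + c K * L a r
    N-r′ a = begin
      N a r                                                     ≡⟨ N-r a ⟩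
      M a r + ∑[ s < suc K ] (c s * M a (g s))                  ≡⟨ cong (M a r +_) (∑-init-last K (λ s → c s * M a (g s))) ⟩
      M a r + (∑[ s < K ] (c s * M a (g s)) + c K * M a (g K))  ≡⟨ sym (ℤ.+-assoc (M a r) _ _) ⟩
      (M a r + ∑[ s < K ] (c s * M a (g s))) + c K * M a (g K)
        ≡⟨ sym (cong₂ (λ u v → u + c K * v) (replaceColumn-≡ M r _ a) (replaceColumn-≡ M r _ a)) ⟩
      N′ a r + c K * L a r ∎
    L≡0 : det′ n L ≡ 0ℤ
    L≡0 = det′-equalColumns n gK<r r<n L
      (λ a → trans (replaceColumn-≢ M r _ a (ℕ.<⇒≢ gK<r)) (sym (replaceColumn-≡ M r _ a)))

  -- W r agrees with X left of column r and with the transformed matrix from column r on;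
  -- W r and W (r + 1) differ by adding multiples of earlier columns to column r.
  module _ (E : ℕ → ℤ) (E₀≡1 : E 0 ≡ 1ℤ) (X : Matrix) where

    private
      T : Matrix
      T a j = ∑[ t < suc j ] (E t * X a (j ∸ t))

      W : ℕ → Matrix
      W r a j with j <? r
      ... | yes _ = X a j
      ... | no  _ = T a j

      W-< : ∀ {r a j} → j < r → W r a j ≡ X a j
      W-< {r} {a} {j} j<r with j <? r
      ... | yes _   = refl
      ... | no  j≮r = ⊥-elim (j≮r j<r)

      W-≥ : ∀ {r a j} → r ≤ j → W r a j ≡ T a j
      W-≥ {r} {a} {j} r≤j with j <? r
      ... | yes j<r = ⊥-elim (ℕ.<-irrefl refl (ℕ.<-≤-trans j<r r≤j))
      ... | no  _   = refl

      W-step : ∀ n r → r < n → det′ n (W r) ≡ det′ n (W (suc r))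
      W-step n r r<n = det′-addEarlierColumns n r r<n r (λ s → E (suc s)) (λ s → r ∸ suc s)
        (λ { s (s≤s s<r) → s≤s (ℕ.m∸n≤m _ s) }) (W (suc r)) (W r) W-other W-r
        where
        W-other : ∀ a j → j ≢ r → W r a j ≡ W (suc r) a j
        W-other a j j≢r with ℕ.<-cmp j r
        ... | tri< j<r _ _   = trans (W-< j<r) (sym (W-< (ℕ.<-trans j<r (ℕ.n<1+n r))))
        ... | tri≈ _ j≡r _   = ⊥-elim (j≢r j≡r)
        ... | tri> _ _ r<j   = trans (W-≥ (ℕ.<⇒≤ r<j)) (sym (W-≥ r<j))
        W-r : ∀ a → W r a r ≡ W (suc r) a r + ∑[ s < r ] (E (suc s) * W (suc r) a (r ∸ suc s))
        W-r a = trans (W-≥ ℕ.≤-refl)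
          (cong₂ _+_ (trans (cong (_* X a r) E₀≡1) (trans (ℤ.*-identityˡ (X a r)) (sym (W-< (ℕ.n<1+n r)))))
            (∑-cong r (λ s _ → cong (E (suc s) *_) (sym (W-< (s≤s (ℕ.m∸n≤m r (suc s))))))))

      W≡X : ∀ n d r → r ℕ.+ d ≡ n → det′ n (W r) ≡ det′ n X
      W≡X n zero    r r+0≡n = det′-cong n λ a b _ b<n →
        W-< (subst (b <_) (trans (sym r+0≡n) (ℕ.+-identityʳ r)) b<n)
      W≡X n (suc d) r r+sd≡n = trans (W-step n r r<n) (W≡X n d (suc r) (trans (sym (ℕ.+-suc r d)) r+sd≡n))
        where
        r<n : r < n
        r<n = subst (r <_) r+sd≡n (ℕ.m<m+n r (s≤s z≤n))

    det′-unitriangularColumnOp : ∀ n → det′ n (λ a j → ∑[ t < suc j ] (E t * X a (j ∸ t))) ≡ det′ n X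
    det′-unitriangularColumnOp n = trans (det′-cong-≗ n λ a j → sym (W-≥ z≤n)) (W≡X n n 0 refl)

  det′-unitriangularRowOp : ∀ n (E : ℕ → ℤ) → E 0 ≡ 1ℤ → ∀ Y →
    det′ n (λ a j → ∑[ t < suc a ] (E t * Y (a ∸ t) j)) ≡ det′ n Y
  det′-unitriangularRowOp n E E₀≡1 Y = begin
    det′ n (λ a j → ∑[ t < suc a ] (E t * Y (a ∸ t) j))  ≡⟨ det′-transpose n _ ⟩
    det′ n (λ j a → ∑[ t < suc a ] (E t * Y (a ∸ t) j))  ≡⟨ det′-unitriangularColumnOp E E₀≡1 (λ a b → Y b a) n ⟩
    det′ n (λ a b → Y b a)                               ≡⟨ sym (det′-transpose n Y) ⟩
    det′ n Y ∎
    where open ≡-Reasoning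

  δ : ℕ → ℕ → ℤ
  δ x y = if x ℕ.≡ᵇ y then 1ℤ else 0ℤ

  δ-refl : ∀ x → δ x x ≡ 1ℤ
  δ-refl zero    = refl
  δ-refl (suc x) = δ-refl x

  δ-≢ : ∀ {x y} → x ≢ y → δ x y ≡ 0ℤ
  δ-≢ {zero}  {zero}  x≢y = ⊥-elim (x≢y refl)
  δ-≢ {zero}  {suc y} x≢y = refl
  δ-≢ {suc x} {zero}  x≢y = refl
  δ-≢ {suc x} {suc y} x≢y = δ-≢ (x≢y ∘ cong suc)

  -- ε k = (-1)^(k(k+1)/2) is the sign of the order-reversing permutation of k+1 elements.
  ε : ℕ → ℤ
  ε zero    = 1ℤ
  ε (suc k) = signPow (suc k) * ε k

  AntidiagonalRows : ℕ → Matrix → Set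
  AntidiagonalRows k M = ∀ a j → a ≤ k → M a j ≡ δ (a ℕ.+ j) k

  minor-antidiagonalRows : ∀ k M → AntidiagonalRows (suc k) M → AntidiagonalRows k (minor M (suc k))
  minor-antidiagonalRows k M rows a j a≤k = trans (rows (suc a) (punchInℕ (suc k) j) (s≤s a≤k)) (case j <? suc k of λ where
      (yes j<sk) → cong (λ z → δ (a ℕ.+ z) k) (punchInℕ-< j<sk)
      (no j≮sk)  → let k<j = ℕ.≰⇒> (j≮sk ∘ s≤s) in
        trans (cong (λ z → δ (a ℕ.+ z) k) (punchInℕ-≥ k<j))
          (trans (δ-≢ (beyond (ℕ.<-trans k<j (ℕ.n<1+n j)))) (sym (δ-≢ (beyond k<j)))))
    where
    beyond : ∀ {i} → k < i → a ℕ.+ i ≢ k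
    beyond k<i eq = ℕ.<-irrefl (sym eq) (ℕ.<-≤-trans k<i (ℕ.m≤n+m _ a))

  det′-antidiagonalRows : ∀ k m M → AntidiagonalRows k M →
    det′ (suc k ℕ.+ m) M ≡ ε k * det′ m (λ a j → M (suc k ℕ.+ a) (suc k ℕ.+ j))
  det′-antidiagonalRows k m M rows = trans firstRow (rest k M rows)
    where
    firstRow : det′ (suc k ℕ.+ m) M ≡ signPow k * (M 0 k * det′ (k ℕ.+ m) (minor M k))
    firstRow = ∑-single (suc (k ℕ.+ m)) k (λ c → signPow c * (M 0 c * det′ (k ℕ.+ m) (minor M c))) (s≤s (ℕ.m≤m+n k m))
      λ c _ c≢k → begin
      signPow c * (M 0 c * det′ (k ℕ.+ m) (minor M c))
        ≡⟨ cong (λ v → signPow c * (v * det′ (k ℕ.+ m) (minor M c))) (trans (rows 0 c z≤n) (δ-≢ c≢k)) ⟩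
      signPow c * (0ℤ * det′ (k ℕ.+ m) (minor M c))     ≡⟨ cong (signPow c *_) (ℤ.*-zeroˡ (det′ (k ℕ.+ m) (minor M c))) ⟩
      signPow c * 0ℤ                                     ≡⟨ ℤ.*-zeroʳ (signPow c) ⟩
      0ℤ ∎
      where open ≡-Reasoning
    rest : ∀ k M → AntidiagonalRows k M →
      signPow k * (M 0 k * det′ (k ℕ.+ m) (minor M k)) ≡ ε k * det′ m (λ a j → M (suc k ℕ.+ a) (suc k ℕ.+ j))
    rest zero    M rows rewrite rows 0 0 z≤n = cong (1ℤ *_) (ℤ.*-identityˡ _)
    rest (suc k) M rows = begin
      signPow (suc k) * (M 0 (suc k) * det′ (suc k ℕ.+ m) (minor M (suc k)))
        ≡⟨ cong₂ (λ u v → signPow (suc k) * (u * v)) (trans (rows 0 (suc k) z≤n) (δ-refl (suc k)))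
             (det′-antidiagonalRows k m (minor M (suc k)) (minor-antidiagonalRows k M rows)) ⟩
      signPow (suc k) * (1ℤ * (ε k * det′ m (λ a j → M (suc (suc k ℕ.+ a)) (punchInℕ (suc k) (suc k ℕ.+ j)))))
        ≡⟨ cong (λ v → signPow (suc k) * (1ℤ * (ε k * v)))
             (det′-cong-≗ m (λ a j → cong (M (suc (suc k ℕ.+ a))) (punchInℕ-≥ (ℕ.m≤m+n (suc k) j)))) ⟩
      signPow (suc k) * (1ℤ * (ε k * Block))
        ≡⟨ solve 3 (λ s e d → s :* (con 1ℤ :* (e :* d)) := (s :* e) :* d) refl (signPow (suc k)) (ε k) Block ⟩
      ε (suc k) * Block ∎
      where
      open ≡-Reasoning
      Block = det′ m (λ a j → M (suc (suc k) ℕ.+ a) (suc (suc k) ℕ.+ j))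

  sumFin≡∑ : ∀ n (f : ℕ → ℤ) → sumFin n (λ j → f (toℕ j)) ≡ ∑< n f
  sumFin≡∑ zero    f = refl
  sumFin≡∑ (suc n) f = cong (f 0 +_) (sumFin≡∑ n (λ i → f (suc i)))

  sumFin-cong : ∀ n {f g : Fin n → ℤ} → (∀ i → f i ≡ g i) → sumFin n f ≡ sumFin n g
  sumFin-cong zero    f≡g = refl
  sumFin-cong (suc n) f≡g = cong₂ _+_ (f≡g Fin.zero) (sumFin-cong n (f≡g ∘ Fin.suc))

  det-cong : ∀ n {M N : Fin n → Fin n → ℤ} → (∀ i j → M i j ≡ N i j) → det n M ≡ det n N
  det-cong zero    M≡N = refl
  det-cong (suc n) M≡N = sumFin-cong (suc n) λ j →
    cong₂ (λ u v → signPow (toℕ j) * (u * v)) (M≡N Fin.zero j) (det-cong n (λ i k → M≡N (Fin.suc i) (Fin.punchIn j k)))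

  toℕ-punchIn : ∀ {n} (j : Fin (suc n)) (k : Fin n) → toℕ (Fin.punchIn j k) ≡ punchInℕ (toℕ j) (toℕ k)
  toℕ-punchIn Fin.zero    k          = refl
  toℕ-punchIn (Fin.suc j) Fin.zero    = refl
  toℕ-punchIn (Fin.suc j) (Fin.suc k) = cong suc (toℕ-punchIn j k)

  det≡det′ : ∀ n M → det n (λ i j → M (toℕ i) (toℕ j)) ≡ det′ n M
  det≡det′ zero    M = refl
  det≡det′ (suc n) M = trans
    (sumFin-cong (suc n) λ j → cong (λ v → signPow (toℕ j) * (M 0 (toℕ j) * v))
      (trans (det-cong n (λ i k → cong (M (suc (toℕ i))) (toℕ-punchIn j k))) (det≡det′ n (minor M (toℕ j)))))
    (sumFin≡∑ (suc n) (λ c → signPow c * (M 0 c * det′ n (minor M c))))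

open Determinants

module PowerSeries where

  open import Data.Integer using (_+_)
  open +-*-Solver using (solve; _:=_; _:+_; _:*_; con)

  infixl 7 _⊛_

  _⊛_ : Series → Series → Series
  (f ⊛ g) n = ∑[ i < suc n ] (f i * g (n ∸ i))

  VanishesBelow : ℕ → Series → Set
  VanishesBelow e X = ∀ i → i < e → X i ≡ 0ℤ

  monomial : ℕ → Series
  monomial k m = δ m k

  0S : Series
  0S _ = 0ℤ

  constant : ℤ → Series
  constant c zero    = c
  constant c (suc n) = 0ℤ

  sumUpTo≡∑ : ∀ m g → sumUpTo m g ≡ ∑< (suc m) g
  sumUpTo≡∑ zero    g = sym (ℤ.+-identityʳ (g 0))
  sumUpTo≡∑ (suc m) g = trans (cong (_+ g (suc m)) (sumUpTo≡∑ m g)) (sym (∑-init-last (suc m) g))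

  sub≡∸ : ∀ m n → sub m n ≡ m ∸ n
  sub≡∸ m       zero    = refl
  sub≡∸ zero    (suc n) = refl
  sub≡∸ (suc m) (suc n) = sub≡∸ m n

  mulS≗⊛ : ∀ f g → mulS f g ≗ f ⊛ g
  mulS≗⊛ f g n = trans (sumUpTo≡∑ n _) (∑-cong (suc n) λ i _ → cong (λ z → f i * g z) (sub≡∸ n i))

  ⊛-cong : ∀ {f f′ g g′} → f ≗ f′ → g ≗ g′ → f ⊛ g ≗ f′ ⊛ g′
  ⊛-cong f≗f′ g≗g′ n = ∑-cong (suc n) λ i _ → cong₂ _*_ (f≗f′ i) (g≗g′ (n ∸ i))

  ⊛-comm : ∀ f g → f ⊛ g ≗ g ⊛ f
  ⊛-comm f g n = trans (∑-reverse (suc n) (λ i → f i * g (n ∸ i))) (∑-cong (suc n) λ i i≤n →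
    trans (ℤ.*-comm (f (n ∸ i)) (g (n ∸ (n ∸ i)))) (cong (λ z → g z * f (n ∸ i)) (ℕ.m∸[m∸n]≡n (ℕ.≤-pred i≤n))))

  ⊛-identityˡ : ∀ f → oneS ⊛ f ≗ f
  ⊛-identityˡ f n = trans (cong₂ _+_ (ℤ.*-identityˡ (f n)) (∑-zero n λ i _ → ℤ.*-zeroˡ (f (n ∸ suc i))))
                          (ℤ.+-identityʳ (f n))

  ⊛-distribʳ : ∀ f g h → addS g h ⊛ f ≗ addS (g ⊛ f) (h ⊛ f)
  ⊛-distribʳ f g h n = trans (∑-cong (suc n) λ i _ → ℤ.*-distribʳ-+ (f (n ∸ i)) (g i) (h i))
                             (∑-distrib-+ (suc n) (λ i → g i * f (n ∸ i)) (λ i → h i * f (n ∸ i)))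

  -- (f ⊛ g) (suc n) unfolds to f 0 * g (suc n) + ((f ∘ suc) ⊛ g) n, which drives the induction.
  ⊛-assoc : ∀ f g h → (f ⊛ g) ⊛ h ≗ f ⊛ (g ⊛ h)
  ⊛-assoc f g h zero =
    solve 3 (λ a b c → (a :* b :+ con 0ℤ) :* c :+ con 0ℤ := a :* (b :* c :+ con 0ℤ) :+ con 0ℤ) refl (f 0) (g 0) (h 0)
  ⊛-assoc f g h (suc m) = begin
    (f ⊛ g) 0 * h (suc m) + ((λ i → f 0 * g (suc i) + (f′ ⊛ g) i) ⊛ h) m
      ≡⟨ cong ((f ⊛ g) 0 * h (suc m) +_) (linear m) ⟩
    (f ⊛ g) 0 * h (suc m) + (f 0 * (g′ ⊛ h) m + ((f′ ⊛ g) ⊛ h) m)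
      ≡⟨ cong (λ z → (f ⊛ g) 0 * h (suc m) + (f 0 * (g′ ⊛ h) m + z)) (⊛-assoc f′ g h m) ⟩
    (f 0 * g 0 + 0ℤ) * h (suc m) + (f 0 * (g′ ⊛ h) m + (f′ ⊛ (g ⊛ h)) m)
      ≡⟨ solve 5 (λ a b c x y → (a :* b :+ con 0ℤ) :* c :+ (a :* x :+ y) := a :* (b :* c :+ x) :+ y) refl
           (f 0) (g 0) (h (suc m)) ((g′ ⊛ h) m) ((f′ ⊛ (g ⊛ h)) m) ⟩
    f 0 * (g 0 * h (suc m) + (g′ ⊛ h) m) + (f′ ⊛ (g ⊛ h)) m ∎
    where
    open ≡-Reasoning
    f′ g′ : Series
    f′ i = f (suc i)
    g′ i = g (suc i)
    linear : ∀ n → ((λ i → f 0 * g′ i + (f′ ⊛ g) i) ⊛ h) n ≡ f 0 * (g′ ⊛ h) n + ((f′ ⊛ g) ⊛ h) n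
    linear n = begin
      ∑[ i < suc n ] ((f 0 * g′ i + (f′ ⊛ g) i) * h (n ∸ i))
        ≡⟨ ∑-cong (suc n) (λ i _ → solve 4 (λ a u v w → (a :* u :+ v) :* w := a :* (u :* w) :+ v :* w) refl
             (f 0) (g′ i) ((f′ ⊛ g) i) (h (n ∸ i))) ⟩
      ∑[ i < suc n ] (f 0 * (g′ i * h (n ∸ i)) + (f′ ⊛ g) i * h (n ∸ i))
        ≡⟨ ∑-distrib-+ (suc n) (λ i → f 0 * (g′ i * h (n ∸ i))) (λ i → (f′ ⊛ g) i * h (n ∸ i)) ⟩
      ∑[ i < suc n ] (f 0 * (g′ i * h (n ∸ i))) + ((f′ ⊛ g) ⊛ h) n
        ≡⟨ cong (_+ ((f′ ⊛ g) ⊛ h) n) (sym (*-distribˡ-∑ (suc n) (f 0) (λ i → g′ i * h (n ∸ i)))) ⟩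
      f 0 * (g′ ⊛ h) n + ((f′ ⊛ g) ⊛ h) n ∎

  series-isCommutativeRing : IsCommutativeRing addS _⊛_ negS 0S oneS
  series-isCommutativeRing = record
    { isRing = record
      { +-isAbelianGroup = Pointwise.isAbelianGroup ℤ.+-0-isAbelianGroup
      ; *-cong           = ⊛-cong
      ; *-assoc          = ⊛-assoc
      ; *-identity       = ⊛-identityˡ , λ f n → trans (⊛-comm f oneS n) (⊛-identityˡ f n)
      ; distrib          = (λ f g h n → trans (⊛-comm f (addS g h) n)
                                        (trans (⊛-distribʳ f g h n) (cong₂ _+_ (⊛-comm g f n) (⊛-comm h f n))))
                         , ⊛-distribʳ
      }
    ; *-comm = ⊛-comm
    }

  seriesRing : CommutativeRing _ _
  seriesRing = record { isCommutativeRing = series-isCommutativeRing }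

  constant-morphism : ℤ.+-*-rawRing -Raw-AlmostCommutative⟶ fromCommutativeRing seriesRing
  constant-morphism = record
    { ⟦_⟧    = constant
    ; +-homo = λ { a b zero → refl ; a b (suc n) → refl }
    ; *-homo = λ { a b zero → sym (ℤ.+-identityʳ (a * b))
                 ; a b (suc n) → sym (cong₂ _+_ (ℤ.*-zeroʳ a) (∑-zero (suc n) λ i _ → ℤ.*-zeroˡ (constant b (n ∸ i)))) }
    ; -‿homo = λ { a zero → refl ; a (suc n) → refl }
    ; 0-homo = λ { zero → refl ; (suc n) → refl }
    ; 1-homo = λ { zero → refl ; (suc n) → refl }
    }

  constant-≟ : ∀ a b → Maybe (constant a ≗ constant b)
  constant-≟ a b with a ℤ.≟ b
  ... | yes refl = just (λ _ → refl)
  ... | no  _    = nothing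

  module SeriesSolver = Algebra.Solver.Ring ℤ.+-*-rawRing (fromCommutativeRing seriesRing) constant-morphism constant-≟

open PowerSeries

module SeriesAlgebra where

  open import Data.Integer using (_+_)
  open SeriesSolver using (solve; _:=_; _:+_; _:*_; :-_; _:-_)
  open import Algebra.Properties.Semiring.Exp (AlmostCommutativeRing.semiring (fromCommutativeRing seriesRing)) using (_^_) public

  module R = CommutativeRing seriesRing

  infixl 6 _⊕_ _⊖_

  _⊕_ _⊖_ : Series → Series → Series
  _⊕_ = addS
  f ⊖ g = addS f (negS g)

  q : Series
  q = shiftQ oneS

  poly : List ℤ → Series
  poly []       = constant 0ℤ
  poly (c ∷ cs) = constant c ⊕ q ⊛ poly cs

  q⊛≗shiftQ : ∀ f → q ⊛ f ≗ shiftQ f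
  q⊛≗shiftQ f zero    = refl
  q⊛≗shiftQ f (suc n) = trans (ℤ.+-identityˡ _) (⊛-identityˡ f n)

  shiftQⁿ : ℕ → Series → Series
  shiftQⁿ zero    f = f
  shiftQⁿ (suc n) f = shiftQ (shiftQⁿ n f)

  shiftQ-cong : ∀ {f g} → f ≗ g → shiftQ f ≗ shiftQ g
  shiftQ-cong f≗g zero    = refl
  shiftQ-cong f≗g (suc n) = f≗g n

  q^⊛≗shiftQⁿ : ∀ n f → q ^ n ⊛ f ≗ shiftQⁿ n f
  q^⊛≗shiftQⁿ zero    f m = ⊛-identityˡ f m
  q^⊛≗shiftQⁿ (suc n) f m = trans (⊛-assoc q (q ^ n) f m)
    (trans (⊛-cong {q} (λ _ → refl) (q^⊛≗shiftQⁿ n f) m) (q⊛≗shiftQ (shiftQⁿ n f) m))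

  shiftQⁿ-+ : ∀ n f m → shiftQⁿ n f (n ℕ.+ m) ≡ f m
  shiftQⁿ-+ zero    f m = refl
  shiftQⁿ-+ (suc n) f m = shiftQⁿ-+ n f m

  shiftQⁿ-< : ∀ n f {i} → i < n → shiftQⁿ n f i ≡ 0ℤ
  shiftQⁿ-< (suc n) f {zero}  _         = refl
  shiftQⁿ-< (suc n) f {suc i} (s≤s i<n) = shiftQⁿ-< n f i<n

  q^≗monomial : ∀ k → q ^ k ≗ monomial k
  q^≗monomial k m = trans (sym (trans (⊛-comm (q ^ k) oneS m) (⊛-identityˡ (q ^ k) m)))
                         (trans (q^⊛≗shiftQⁿ k oneS m) (shiftQⁿ-oneS k m))
    where
    shiftQⁿ-oneS : ∀ k m → shiftQⁿ k oneS m ≡ monomial k m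
    shiftQⁿ-oneS zero    zero    = refl
    shiftQⁿ-oneS zero    (suc m) = refl
    shiftQⁿ-oneS (suc k) zero    = refl
    shiftQⁿ-oneS (suc k) (suc m) = shiftQⁿ-oneS k m

  poly-head : ∀ {n} (p : Vec ℤ (suc n)) → poly (toList p) 0 ≡ head p
  poly-head (c ∷ cs) = ℤ.+-identityʳ c

  poly-degree : ∀ cs {n} → length cs ≤ n → poly cs n ≡ 0ℤ
  poly-degree []       {zero}  _         = refl
  poly-degree []       {suc n} _         = refl
  poly-degree (c ∷ cs) {suc n} (s≤s len≤n) = trans (ℤ.+-identityˡ _) (trans (q⊛≗shiftQ (poly cs) (suc n)) (poly-degree cs len≤n))

  Regular : Series → Set
  Regular d = ∀ {Z} → d ⊛ Z ≗ 0S → Z ≗ 0S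

  q^-regular : ∀ e → Regular (q ^ e)
  q^-regular e {Z} q^Z≗0 n = trans (sym (shiftQⁿ-+ e Z n)) (trans (sym (q^⊛≗shiftQⁿ e Z (e ℕ.+ n))) (q^Z≗0 (e ℕ.+ n)))

  invertible-regular : ∀ {C V} → C ⊛ V ≗ oneS → Regular C
  invertible-regular {C} {V} C⊛V≗1 {Z} C⊛Z≗0 = begin
    Z                  ≈˘⟨ R.*-identityˡ Z ⟩
    oneS ⊛ Z           ≈˘⟨ R.*-congʳ {Z} C⊛V≗1 ⟩
    C ⊛ V ⊛ Z          ≈⟨ solve 3 (λ C V Z → C :* V :* Z := V :* (C :* Z)) R.refl C V Z ⟩
    V ⊛ (C ⊛ Z)        ≈⟨ R.*-congˡ {V} C⊛Z≗0 ⟩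
    V ⊛ 0S             ≈⟨ R.zeroʳ V ⟩
    0S ∎
    where open import Relation.Binary.Reasoning.Setoid R.setoid

  ⊛-regular : ∀ {d d′} → Regular d → Regular d′ → Regular (d ⊛ d′)
  ⊛-regular {d} {d′} d-regular d′-regular {Z} dd′Z≗0 =
    d′-regular (d-regular (R.trans (R.sym (⊛-assoc d d′ Z)) dd′Z≗0))

  record Quotient (F N : Series) : Set where
    field
      denominator : Series
      regular     : Regular denominator
      equation    : denominator ⊛ F ≗ N

  signed : Bool → Series → Series
  signed false f = f
  signed true  f = negS f

  sign : Bool → ℕ → ℤ
  sign false n = 1ℤ
  sign true  n = signPow n

  sign² : ∀ b n → sign b n * sign b n ≡ 1ℤ
  sign² false n       = refl
  sign² true  zero    = refl
  sign² true  (suc n) = trans (sym (ℤ.neg-distribʳ-* (- signPow n) (signPow n)))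
                              (trans (cong -_ (sym (ℤ.neg-distribˡ-* (signPow n) (signPow n))))
                                     (trans (ℤ.neg-involutive _) (sign² true n)))

  signed-quotient : ∀ b {F N} → Quotient F N → Quotient (signed b F) (signed b N)
  signed-quotient b {F} {N} quot = record { denominator = denominator ; regular = regular ; equation = equation′ b }
    where
    open Quotient quot
    equation′ : ∀ b → denominator ⊛ signed b F ≗ signed b N
    equation′ false = equation
    equation′ true  = R.trans (solve 2 (λ d F → d :* :- F := :- (d :* F)) R.refl denominator F) (R.-‿cong equation)

  -- The defect (P - Q G) F - Qk vanishes after multiplication by the regular series dF · dG.
  clear-denominators : ∀ {F G N M P Q Qk} (quotF : Quotient F N) (quotG : Quotient G M) →
    let dF = Quotient.denominator quotF; dG = Quotient.denominator quotG in
    (P ⊛ dG ⊖ Q ⊛ M) ⊛ N ≗ dF ⊛ dG ⊛ Qk → (P ⊖ Q ⊛ G) ⊛ F ≗ Qk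
  clear-denominators {F} {G} {N} {M} {P} {Q} {Qk} quotF quotG cleared = begin
    (P ⊖ Q ⊛ G) ⊛ F         ≈⟨ solve 2 (λ X Y → X := (X :- Y) :+ Y) R.refl ((P ⊖ Q ⊛ G) ⊛ F) Qk ⟩
    Z ⊕ Qk                  ≈⟨ R.+-congʳ {Qk} (⊛-regular {F.denominator} {G.denominator} F.regular G.regular {Z} Z-cleared) ⟩
    0S ⊕ Qk                 ≈⟨ R.+-identityˡ Qk ⟩
    Qk ∎
    where
    open import Relation.Binary.Reasoning.Setoid R.setoid
    module F = Quotient quotF
    module G = Quotient quotG
    Z : Series
    Z = (P ⊖ Q ⊛ G) ⊛ F ⊖ Qk
    Z-cleared : F.denominator ⊛ G.denominator ⊛ Z ≗ 0S
    Z-cleared = begin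
      F.denominator ⊛ G.denominator ⊛ Z
        ≈⟨ solve 7 (λ dF dG P Q G F Qk →
             dF :* dG :* ((P :- Q :* G) :* F :- Qk) := (P :* dG :- Q :* (dG :* G)) :* (dF :* F) :- dF :* dG :* Qk)
             R.refl F.denominator G.denominator P Q G F Qk ⟩
      (P ⊛ G.denominator ⊖ Q ⊛ (G.denominator ⊛ G)) ⊛ (F.denominator ⊛ F) ⊖ F.denominator ⊛ G.denominator ⊛ Qk
        ≈⟨ R.+-congʳ {negS (F.denominator ⊛ G.denominator ⊛ Qk)}
             (R.*-cong (R.+-congˡ {P ⊛ G.denominator} (R.-‿cong (R.*-congˡ {Q} G.equation))) F.equation) ⟩
      (P ⊛ G.denominator ⊖ Q ⊛ M) ⊛ N ⊖ F.denominator ⊛ G.denominator ⊛ Qk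
        ≈⟨ R.+-congʳ {negS (F.denominator ⊛ G.denominator ⊛ Qk)} cleared ⟩
      F.denominator ⊛ G.denominator ⊛ Qk ⊖ F.denominator ⊛ G.denominator ⊛ Qk
        ≈⟨ R.-‿inverseʳ (F.denominator ⊛ G.denominator ⊛ Qk) ⟩
      0S ∎

  unshiftQⁿ : ℕ → Series → Series
  unshiftQⁿ e X n = X (e ℕ.+ n)

  q^⊛unshiftQⁿ : ∀ e X → VanishesBelow e X → q ^ e ⊛ unshiftQⁿ e X ≗ X
  q^⊛unshiftQⁿ e X low n = trans (q^⊛≗shiftQⁿ e (unshiftQⁿ e X) n) (shifted n)
    where
    shifted : ∀ n → shiftQⁿ e (unshiftQⁿ e X) n ≡ X n
    shifted n with n ℕ.<? e
    ... | yes n<e = trans (shiftQⁿ-< e (unshiftQⁿ e X) n<e) (sym (low n n<e))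
    ... | no  n≮e = begin
      shiftQⁿ e (unshiftQⁿ e X) n          ≡⟨ cong (shiftQⁿ e (unshiftQⁿ e X)) (sym n≡) ⟩
      shiftQⁿ e (unshiftQⁿ e X) (e ℕ.+ m)  ≡⟨ shiftQⁿ-+ e (unshiftQⁿ e X) m ⟩
      X (e ℕ.+ m)                      ≡⟨ cong X n≡ ⟩
      X n ∎
      where
      open ≡-Reasoning
      m = n ∸ e
      n≡ : e ℕ.+ m ≡ n
      n≡ = ℕ.m+[n∸m]≡n (ℕ.≮⇒≥ n≮e)

  ⊛-vanishesBelow : ∀ {e} N V → VanishesBelow e N → VanishesBelow e (N ⊛ V)
  ⊛-vanishesBelow N V low i i<e = ∑-zero (suc i) λ t t≤i →
    trans (cong (_* V (i ∸ t)) (low t (ℕ.<-≤-trans t≤i i<e))) (ℤ.*-zeroˡ (V (i ∸ t)))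

  division : ∀ {N C V} e → C ⊛ V ≗ oneS → VanishesBelow e N → Quotient (unshiftQⁿ e (N ⊛ V)) N
  division {N} {C} {V} e C⊛V≗1 low = record
    { denominator = q ^ e ⊛ C
    ; regular     = ⊛-regular {q ^ e} {C} (q^-regular e) (invertible-regular {C} {V} C⊛V≗1)
    ; equation    = begin
        q ^ e ⊛ C ⊛ unshiftQⁿ e (N ⊛ V)
          ≈⟨ solve 3 (λ Q C X → Q :* C :* X := C :* (Q :* X)) R.refl (q ^ e) C (unshiftQⁿ e (N ⊛ V)) ⟩
        C ⊛ (q ^ e ⊛ unshiftQⁿ e (N ⊛ V))  ≈⟨ R.*-congˡ {C} (q^⊛unshiftQⁿ e (N ⊛ V) (⊛-vanishesBelow N V low)) ⟩
        C ⊛ (N ⊛ V)                    ≈⟨ solve 3 (λ C N V → C :* (N :* V) := C :* V :* N) R.refl C N V ⟩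
        C ⊛ V ⊛ N                      ≈⟨ R.*-congʳ {N} C⊛V≗1 ⟩
        oneS ⊛ N                       ≈⟨ R.*-identityˡ N ⟩
        N ∎
    }
    where open import Relation.Binary.Reasoning.Setoid R.setoid

open SeriesAlgebra

module HankelContinuedFractions where

  open import Data.Integer using (_+_)
  open +-*-Solver using (solve; _:=_; _:+_; _:-_)

  hankelMatrix : Series → Matrix
  hankelMatrix F a b = F (a ℕ.+ b)

  -- G.-N. Han, Hankel continued fraction and its applications, Adv. Math. 303 (2016).  Column operations with the
  -- coefficients of D turn the Hankel matrix of F into one whose first k + 1 rows form an antidiagonal unit block and
  -- whose lower right block is a unitriangular row transform of the Hankel matrix of G.
  module HanTheorem (F D : Series) (k : ℕ) (D₀≡1 : D 0 ≡ 1ℤ) (D⊛F≗qᵏ : D ⊛ F ≗ monomial k) where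

    G : Series
    G m = - D (suc (suc k) ℕ.+ m)

    private
      ∸-suc-< : ∀ {m t} → t < m → m ∸ suc t < m
      ∸-suc-< {suc m} {t} _ = s≤s (ℕ.m∸n≤m m t)

      F-leading : ∀ m → VanishesBelow m F → F m ≡ δ m k
      F-leading m below = trans (sym leading) (D⊛F≗qᵏ m)
        where
        leading : (D ⊛ F) m ≡ F m
        leading = trans (cong₂ _+_ (trans (cong (_* F m) D₀≡1) (ℤ.*-identityˡ (F m)))
                                   (∑-zero m λ t t<m → trans (cong (D (suc t) *_) (below (m ∸ suc t) (∸-suc-< t<m)))
                                                           (ℤ.*-zeroʳ (D (suc t)))))
                        (ℤ.+-identityʳ (F m))

      F-below : ∀ m → m ≤ k → VanishesBelow m F
      F-below (suc m) sm≤k i (s≤s i≤m) with ℕ.m≤n⇒m<n∨m≡n i≤m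
      ... | inj₁ i<m  = F-below m (ℕ.<⇒≤ sm≤k) i i<m
      ... | inj₂ refl = trans (F-leading i (F-below i (ℕ.<⇒≤ sm≤k))) (δ-≢ (ℕ.<⇒≢ sm≤k))

      F-below-k : VanishesBelow k F
      F-below-k = F-below k ℕ.≤-refl

      F-k : F k ≡ 1ℤ
      F-k = trans (F-leading k F-below-k) (δ-refl k)

    hankel-vanishes : ∀ n → suc n ≤ k → det′ (suc n) (hankelMatrix F) ≡ 0ℤ
    hankel-vanishes n sn≤k = det′-zero-firstRow n (hankelMatrix F) λ b b<sn → F-below-k b (ℕ.<-≤-trans b<sn sn≤k)

    private
      reduced tail : Matrix
      reduced a j = ∑[ t < suc j ] (D t * F (a ℕ.+ (j ∸ t)))
      tail    a j = ∑[ i < a ] (D (suc j ℕ.+ i) * F (a ∸ suc i))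

      reduced+tail : ∀ a j → reduced a j + tail a j ≡ δ (a ℕ.+ j) k
      reduced+tail a j = trans (sym split) (D⊛F≗qᵏ (a ℕ.+ j))
        where
        h : ℕ → ℤ
        h t = D t * F ((a ℕ.+ j) ∸ t)
        split : (D ⊛ F) (a ℕ.+ j) ≡ reduced a j + tail a j
        split = begin
          ∑< (suc (a ℕ.+ j)) h                   ≡⟨ cong (λ c → ∑< (suc c) h) (ℕ.+-comm a j) ⟩
          ∑< (suc j ℕ.+ a) h                     ≡⟨ ∑-split (suc j) a h ⟩
          ∑< (suc j) h + ∑[ i < a ] h (suc j ℕ.+ i)
            ≡⟨ cong₂ _+_ (∑-cong (suc j) λ t t≤j → cong (λ z → D t * F z) (ℕ.+-∸-assoc a (ℕ.≤-pred t≤j)))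
                         (∑-cong a λ i _ → cong (λ z → D (suc j ℕ.+ i) * F z)
                            (trans (cong₂ _∸_ (ℕ.+-comm a j) (sym (ℕ.+-suc j i))) (ℕ.[m+n]∸[m+o]≡n∸o j a (suc i)))) ⟩
          reduced a j + tail a j ∎
          where open ≡-Reasoning

      reduced≡ : ∀ a j → reduced a j ≡ δ (a ℕ.+ j) k - tail a j
      reduced≡ a j = trans (solve 2 (λ x y → x := (x :+ y) :- y) refl (reduced a j) (tail a j))
                           (cong (_- tail a j) (reduced+tail a j))

      reduced-antidiagonal : AntidiagonalRows k reduced
      reduced-antidiagonal a j a≤k = trans (reduced≡ a j) (trans (cong (δ (a ℕ.+ j) k +_) (cong -_ tail≡0)) (ℤ.+-identityʳ _))
        where
        tail≡0 : tail a j ≡ 0ℤ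
        tail≡0 = ∑-zero a λ i i<a → trans (cong (D (suc j ℕ.+ i) *_) (F-below-k (a ∸ suc i) (ℕ.<-≤-trans (∸-suc-< i<a) a≤k)))
                                          (ℤ.*-zeroʳ (D (suc j ℕ.+ i)))

      tail-block : ∀ a j → tail (suc k ℕ.+ a) (suc k ℕ.+ j) ≡ ∑[ i < suc a ] (D (suc (suc k) ℕ.+ (j ℕ.+ i)) * F (k ℕ.+ (a ∸ i)))
      tail-block a j = begin
        ∑< (suc k ℕ.+ a) r                          ≡⟨ cong (λ c → ∑< c r) (trans (ℕ.+-comm (suc k) a) (ℕ.+-suc a k)) ⟩
        ∑< (suc a ℕ.+ k) r                          ≡⟨ ∑-split (suc a) k r ⟩
        ∑< (suc a) r + ∑[ i < k ] r (suc a ℕ.+ i)   ≡⟨ cong₂ _+_ within beyond ⟩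
        ∑[ i < suc a ] (D (suc (suc k) ℕ.+ (j ℕ.+ i)) * F (k ℕ.+ (a ∸ i))) + 0ℤ ≡⟨ ℤ.+-identityʳ _ ⟩
        ∑[ i < suc a ] (D (suc (suc k) ℕ.+ (j ℕ.+ i)) * F (k ℕ.+ (a ∸ i))) ∎
        where
        open ≡-Reasoning
        r : ℕ → ℤ
        r i = D (suc (suc k ℕ.+ j) ℕ.+ i) * F ((suc k ℕ.+ a) ∸ suc i)
        within : ∑< (suc a) r ≡ ∑[ i < suc a ] (D (suc (suc k) ℕ.+ (j ℕ.+ i)) * F (k ℕ.+ (a ∸ i)))
        within = ∑-cong (suc a) λ i i≤a → cong₂ (λ u v → D u * F v) (cong (suc ∘ suc) (ℕ.+-assoc k j i))
                                                                 (ℕ.+-∸-assoc k (ℕ.≤-pred i≤a))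
        beyond : ∑[ i < k ] r (suc a ℕ.+ i) ≡ 0ℤ
        beyond = ∑-zero k λ i i<k → trans
          (cong (D (suc (suc k ℕ.+ j) ℕ.+ (suc a ℕ.+ i)) *_)
            (F-below-k _ (subst (_< k) (sym (trans (cong₂ _∸_ (ℕ.+-comm k a) (sym (ℕ.+-suc a i))) (ℕ.[m+n]∸[m+o]≡n∸o a k (suc i))))
                                       (∸-suc-< i<k))))
          (ℤ.*-zeroʳ (D (suc (suc k ℕ.+ j) ℕ.+ (suc a ℕ.+ i))))

      reduced-block : ∀ a j → reduced (suc k ℕ.+ a) (suc k ℕ.+ j) ≡ ∑[ t < suc a ] (F (k ℕ.+ t) * G (j ℕ.+ (a ∸ t)))
      reduced-block a j = begin
        reduced A B                                 ≡⟨ reduced≡ A B ⟩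
        δ (A ℕ.+ B) k - tail A B
          ≡⟨ cong₂ _-_ (δ-≢ (ℕ.>⇒≢ (ℕ.<-≤-trans (ℕ.n<1+n k) (ℕ.≤-trans (ℕ.m≤m+n (suc k) a) (ℕ.m≤m+n A B)))))
                       (tail-block a j) ⟩
        0ℤ - ∑[ i < suc a ] (D (suc (suc k) ℕ.+ (j ℕ.+ i)) * F (k ℕ.+ (a ∸ i)))
          ≡⟨ trans (ℤ.+-identityˡ _) (neg-distrib-∑ (suc a) tailTerm) ⟩
        ∑[ i < suc a ] (- (D (suc (suc k) ℕ.+ (j ℕ.+ i)) * F (k ℕ.+ (a ∸ i))))
          ≡⟨ ∑-cong (suc a) (λ i _ → trans (ℤ.neg-distribˡ-* (D (suc (suc k) ℕ.+ (j ℕ.+ i))) (F (k ℕ.+ (a ∸ i))))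
                                           (ℤ.*-comm (G (j ℕ.+ i)) (F (k ℕ.+ (a ∸ i))))) ⟩
        ∑[ i < suc a ] (F (k ℕ.+ (a ∸ i)) * G (j ℕ.+ i))
          ≡⟨ ∑-reverse (suc a) (λ i → F (k ℕ.+ (a ∸ i)) * G (j ℕ.+ i)) ⟩
        ∑[ t < suc a ] (F (k ℕ.+ (a ∸ (a ∸ t))) * G (j ℕ.+ (a ∸ t)))
          ≡⟨ ∑-cong (suc a) (λ t t≤a → cong (λ z → F (k ℕ.+ z) * G (j ℕ.+ (a ∸ t))) (ℕ.m∸[m∸n]≡n (ℕ.≤-pred t≤a))) ⟩
        ∑[ t < suc a ] (F (k ℕ.+ t) * G (j ℕ.+ (a ∸ t))) ∎
        where
        open ≡-Reasoning
        A = suc k ℕ.+ a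
        B = suc k ℕ.+ j
        tailTerm : ℕ → ℤ
        tailTerm i = D (suc (suc k) ℕ.+ (j ℕ.+ i)) * F (k ℕ.+ (a ∸ i))

    hankel-shift : ∀ m → det′ (suc k ℕ.+ m) (hankelMatrix F) ≡ ε k * det′ m (hankelMatrix G)
    hankel-shift m = begin
      det′ (suc k ℕ.+ m) (hankelMatrix F)
        ≡⟨ sym (det′-unitriangularColumnOp D D₀≡1 (hankelMatrix F) (suc k ℕ.+ m)) ⟩
      det′ (suc k ℕ.+ m) reduced
        ≡⟨ det′-antidiagonalRows k m reduced reduced-antidiagonal ⟩
      ε k * det′ m (λ a j → reduced (suc k ℕ.+ a) (suc k ℕ.+ j))
        ≡⟨ cong (ε k *_) (det′-cong-≗ m reduced-block) ⟩
      ε k * det′ m (λ a j → ∑[ t < suc a ] (F (k ℕ.+ t) * G (j ℕ.+ (a ∸ t))))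
        ≡⟨ cong (ε k *_) (det′-unitriangularRowOp m (λ t → F (k ℕ.+ t)) (trans (cong F (ℕ.+-identityʳ k)) F-k)
                                                  (λ b j → G (j ℕ.+ b))) ⟩
      ε k * det′ m (λ b j → G (j ℕ.+ b))
        ≡⟨ cong (ε k *_) (det′-cong-≗ m (λ b j → cong G (ℕ.+-comm j b))) ⟩
      ε k * det′ m (hankelMatrix G) ∎
      where open ≡-Reasoning

  det′-signed : ∀ b n F → det′ n (hankelMatrix (signed b F)) ≡ sign b n * det′ n (hankelMatrix F)
  det′-signed false n F = sym (ℤ.*-identityˡ _)
  det′-signed true  n F = det′-neg n (hankelMatrix F)

  det′-unsigned : ∀ b n F → det′ n (hankelMatrix F) ≡ sign b n * det′ n (hankelMatrix (signed b F))
  det′-unsigned b n F = begin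
    det′ n (hankelMatrix F)                            ≡⟨ sym (ℤ.*-identityˡ _) ⟩
    1ℤ * det′ n (hankelMatrix F)                       ≡⟨ cong (_* det′ n (hankelMatrix F)) (sym (sign² b n)) ⟩
    sign b n * sign b n * det′ n (hankelMatrix F)      ≡⟨ ℤ.*-assoc (sign b n) (sign b n) _ ⟩
    sign b n * (sign b n * det′ n (hankelMatrix F))    ≡⟨ cong (sign b n *_) (sym (det′-signed b n F)) ⟩
    sign b n * det′ n (hankelMatrix (signed b F)) ∎
    where open ≡-Reasoning

  record HFraction (F G : Series) : Set where
    field
      k        : ℕ
      p        : Vec ℤ (suc (suc k))
      p₀≡1     : head p ≡ 1ℤ
      equation : (poly (toList p) ⊖ q ^ suc (suc k) ⊛ G) ⊛ F ≗ q ^ k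

  module _ {F G : Series} (h : HFraction F G) where
    open HFraction h

    private
      D : Series
      D = poly (toList p) ⊖ q ^ suc (suc k) ⊛ G

      shifted : ∀ n → (q ^ suc (suc k) ⊛ G) n ≡ shiftQⁿ (suc (suc k)) G n
      shifted = q^⊛≗shiftQⁿ (suc (suc k)) G

      D₀≡1 : D 0 ≡ 1ℤ
      D₀≡1 = cong₂ (λ a b → a + - b) (trans (poly-head p) p₀≡1) (shifted 0)

      open HanTheorem F D k D₀≡1 (λ m → trans (equation m) (q^≗monomial k m))
        renaming (G to G′)

      G′≡G : ∀ m → G′ m ≡ G m
      G′≡G m = begin
        - (poly (toList p) (suc (suc k) ℕ.+ m) + - (q ^ suc (suc k) ⊛ G) (suc (suc k) ℕ.+ m))
          ≡⟨ cong₂ (λ a b → - (a + - b)) (poly-degree (toList p) (ℕ.≤-trans (ℕ.≤-reflexive (length-toList p)) (ℕ.m≤m+n _ m)))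
                                         (trans (shifted _) (shiftQⁿ-+ (suc (suc k)) G m)) ⟩
        - (0ℤ + - G m)  ≡⟨ cong -_ (ℤ.+-identityˡ (- G m)) ⟩
        - - G m         ≡⟨ ℤ.neg-involutive (G m) ⟩
        G m ∎
        where open ≡-Reasoning

    hfraction-hankel-vanishes : ∀ n → suc n ≤ k → det′ (suc n) (hankelMatrix F) ≡ 0ℤ
    hfraction-hankel-vanishes = hankel-vanishes

    hfraction-hankel-shift : ∀ m → det′ (suc k ℕ.+ m) (hankelMatrix F) ≡ ε k * det′ m (hankelMatrix G)
    hfraction-hankel-shift m = trans (hankel-shift m) (cong (ε k *_) (det′-cong-≗ m (λ a b → G′≡G (a ℕ.+ b))))

open HankelContinuedFractions

module PeriodicSequences where

  Periodic : ℕ → (ℕ → ℤ) → Set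
  Periodic p f = ∀ n → f (p ℕ.+ n) ≡ f n

  Periodic-shift : ∀ {p f} c → Periodic p f → Periodic p (λ m → f (c ℕ.+ m))
  Periodic-shift {p} {f} c f-periodic m = trans (cong f (shuffle c p m)) (f-periodic (c ℕ.+ m))
    where
    shuffle : ∀ c p m → c ℕ.+ (p ℕ.+ m) ≡ p ℕ.+ (c ℕ.+ m)
    shuffle c p m = trans (sym (ℕ.+-assoc c p m)) (trans (cong (ℕ._+ m) (ℕ.+-comm c p)) (ℕ.+-assoc p c m))

  Periodic-* : ∀ {p f g} → Periodic p f → Periodic p g → Periodic p (λ m → f m * g m)
  Periodic-* f-periodic g-periodic m = cong₂ _*_ (f-periodic m) (g-periodic m)

  Periodic-multiple : ∀ {p f} n → Periodic p f → Periodic (n ℕ.* p) f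
  Periodic-multiple zero    f-periodic m = refl
  Periodic-multiple {p} {f} (suc n) f-periodic m =
    trans (cong f (ℕ.+-assoc p (n ℕ.* p) m)) (trans (f-periodic _) (Periodic-multiple n f-periodic m))

  signPow-periodic : Periodic 2 signPow
  signPow-periodic n = ℤ.neg-involutive (signPow n)

  sign-periodic : ∀ b → Periodic 12 (sign b)
  sign-periodic false n = refl
  sign-periodic true    = Periodic-multiple {2} 6 signPow-periodic

  cycle : ∀ {p} → Vec ℤ (suc p) → ℕ → ℤ
  cycle {p} v n = lookup v (n mod suc p)

  cycle-periodic : ∀ {p} (v : Vec ℤ (suc p)) → Periodic (suc p) (cycle v)
  cycle-periodic {p} v n = cong (lookup v) (Fin.toℕ-injective (begin
    toℕ ((suc p ℕ.+ n) mod suc p)  ≡⟨ Fin.toℕ-fromℕ< _ ⟩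
    (suc p ℕ.+ n) % suc p          ≡⟨ cong (_% suc p) (ℕ.+-comm (suc p) n) ⟩
    (n ℕ.+ suc p) % suc p          ≡⟨ [m+n]%n≡m%n n (suc p) ⟩
    n % suc p                      ≡⟨ sym (Fin.toℕ-fromℕ< _) ⟩
    toℕ (n mod suc p) ∎))
    where open ≡-Reasoning

  cycle-lookup : ∀ {p} (v : Vec ℤ (suc p)) (i : Fin (suc p)) → cycle v (toℕ i) ≡ lookup v i
  cycle-lookup {p} v i = cong (lookup v) (Fin.toℕ-injective
    (trans (Fin.toℕ-fromℕ< _) (m<n⇒m%n≡m (Fin.toℕ<n i))))

  periodic-ext : ∀ p {f g : ℕ → ℤ} → Periodic (suc p) f → Periodic (suc p) g →
    (∀ (i : Fin (suc p)) → f (toℕ i) ≡ g (toℕ i)) → ∀ n → f n ≡ g n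
  periodic-ext p {f} {g} f-periodic g-periodic onPeriod = <-rec _ step
    where
    step : ∀ n → (∀ {m} → m < n → f m ≡ g m) → f n ≡ g n
    step n below with n ℕ.<? suc p
    ... | yes n<p = subst (λ m → f m ≡ g m) (Fin.toℕ-fromℕ< n<p) (onPeriod (fromℕ< n<p))
    ... | no  n≮p = begin
      f n                      ≡⟨ cong f (sym n≡) ⟩
      f (suc p ℕ.+ m)          ≡⟨ f-periodic m ⟩
      f m                      ≡⟨ below (subst (m <_) n≡ (ℕ.m<n+m m (s≤s z≤n))) ⟩
      g m                      ≡⟨ sym (g-periodic m) ⟩
      g (suc p ℕ.+ m)          ≡⟨ cong g n≡ ⟩
      g n ∎
      where
      open ≡-Reasoning
      m = n ∸ suc p
      n≡ : suc p ℕ.+ m ≡ n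
      n≡ = ℕ.m+[n∸m]≡n (ℕ.≮⇒≥ n≮p)

  module _ {J : Set} (next : J → J) (shift : J → ℕ) (factor : J → ℕ → ℤ) where

    SatisfiesRecursion : (J → ℕ → ℤ) → Set
    SatisfiesRecursion H = ∀ j m → H j (suc (shift j) ℕ.+ m) ≡ factor j m * H (next j) m

    recursion-unique : ∀ {H P} → SatisfiesRecursion H → SatisfiesRecursion P →
      (∀ j n → n ≤ shift j → H j n ≡ P j n) → ∀ n j → H j n ≡ P j n
    recursion-unique {H} {P} H-recursion P-recursion initial = <-rec _ step
      where
      step : ∀ n → (∀ {m} → m < n → ∀ j → H j m ≡ P j m) → ∀ j → H j n ≡ P j n
      step n below j with n ℕ.≤? shift j
      ... | yes n≤shift = initial j n n≤shift
      ... | no  n≰shift = begin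
        H j n                          ≡⟨ cong (H j) (sym n≡) ⟩
        H j (suc (shift j) ℕ.+ m)      ≡⟨ H-recursion j m ⟩
        factor j m * H (next j) m      ≡⟨ cong (factor j m *_) (below (subst (m <_) n≡ (ℕ.m<n+m m (s≤s z≤n))) (next j)) ⟩
        factor j m * P (next j) m      ≡⟨ sym (P-recursion j m) ⟩
        P j (suc (shift j) ℕ.+ m)      ≡⟨ cong (P j) n≡ ⟩
        P j n ∎
        where
        open ≡-Reasoning
        m = n ∸ suc (shift j)
        n≡ : suc (shift j) ℕ.+ m ≡ n
        n≡ = ℕ.m+[n∸m]≡n (ℕ.≰⇒> n≰shift)

open PeriodicSequences

module SilverSeries where

  open import Data.Integer using (_+_; +_)
  open SeriesSolver using (solve; _:=_; _:+_; _:*_; :-_; _:-_; _:^_; con; var; Polynomial; ⟦_⟧)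

  polyᴱ : ∀ {n} → List ℤ → Polynomial n → Polynomial n
  polyᴱ []       x = con 0ℤ
  polyᴱ (c ∷ cs) x = con c :+ x :* polyᴱ cs x

  silverᴱ : ∀ {n} → Polynomial n → Polynomial n → Polynomial n
  silverᴱ q S = q :* S :* S :+ (con 1ℤ :- con (+ 2) :* q :- q :^ 3) :* S :- con 1ℤ

  data UnitFactor : Set where
    one Φ₄ Φ₆ : UnitFactor

  unitFactorᴱ : UnitFactor → ∀ {n} → Polynomial n → Polynomial n
  unitFactorᴱ one x = con 1ℤ
  unitFactorᴱ Φ₄  x = con 1ℤ :+ x :^ 2
  unitFactorᴱ Φ₆  x = con 1ℤ :- x :+ x :^ 2

  unitFactor : UnitFactor → Series
  unitFactor u = ⟦ unitFactorᴱ u (var Fin.zero) ⟧ (q ∷ [])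

  Φ₄⁻¹-period : Vec ℤ 4
  Φ₄⁻¹-period = 1ℤ ∷ 0ℤ ∷ -1ℤ ∷ 0ℤ ∷ []

  Φ₆⁻¹-period : Vec ℤ 6
  Φ₆⁻¹-period = 1ℤ ∷ 1ℤ ∷ 0ℤ ∷ -1ℤ ∷ -1ℤ ∷ 0ℤ ∷ []

  unitFactor⁻¹ : UnitFactor → Series
  unitFactor⁻¹ one = oneS
  unitFactor⁻¹ Φ₄  = cycle Φ₄⁻¹-period
  unitFactor⁻¹ Φ₆  = cycle Φ₆⁻¹-period

  unitFactor-inverse : ∀ u → unitFactor u ⊛ unitFactor⁻¹ u ≗ oneS
  unitFactor-inverse one = solve 1 (λ x → con 1ℤ :* x := x) R.refl oneS
  unitFactor-inverse Φ₄  n = begin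
    (unitFactor Φ₄ ⊛ V) n                 ≡⟨ solve 2 (λ q V → (con 1ℤ :+ q :^ 2) :* V := V :+ q :* (q :* V)) R.refl q V n ⟩
    (V ⊕ q ⊛ (q ⊛ V)) n                   ≡⟨ cong (λ z → V n + z) (trans (q⊛≗shiftQ (q ⊛ V) n) (shiftQ-cong (q⊛≗shiftQ V) n)) ⟩
    V n + shiftQ (shiftQ V) n             ≡⟨ recurrence n ⟩
    oneS n ∎
    where
    open ≡-Reasoning
    V = unitFactor⁻¹ Φ₄
    recurrence : ∀ n → V n + shiftQ (shiftQ V) n ≡ oneS n
    recurrence zero          = refl
    recurrence (suc zero)    = refl
    recurrence (suc (suc m)) = periodic-ext 3 {λ m → V (2 ℕ.+ m) + V m} {λ _ → 0ℤ}
      (λ m → cong₂ _+_ (cycle-periodic Φ₄⁻¹-period (2 ℕ.+ m)) (cycle-periodic Φ₄⁻¹-period m)) (λ _ → refl)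
      (from-yes (Fin.all? {n = 4} λ i → V (2 ℕ.+ toℕ i) + V (toℕ i) ℤ.≟ 0ℤ)) m
  unitFactor-inverse Φ₆  n = begin
    (unitFactor Φ₆ ⊛ V) n
      ≡⟨ solve 2 (λ q V → (con 1ℤ :- q :+ q :^ 2) :* V := V :- q :* V :+ q :* (q :* V)) R.refl q V n ⟩
    (V ⊖ q ⊛ V ⊕ q ⊛ (q ⊛ V)) n
      ≡⟨ cong₂ (λ a b → V n + - a + b) (q⊛≗shiftQ V n) (trans (q⊛≗shiftQ (q ⊛ V) n) (shiftQ-cong (q⊛≗shiftQ V) n)) ⟩
    V n + - shiftQ V n + shiftQ (shiftQ V) n ≡⟨ recurrence n ⟩
    oneS n ∎
    where
    open ≡-Reasoning
    V = unitFactor⁻¹ Φ₆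
    recurrence : ∀ n → V n + - shiftQ V n + shiftQ (shiftQ V) n ≡ oneS n
    recurrence zero          = refl
    recurrence (suc zero)    = refl
    recurrence (suc (suc m)) = periodic-ext 5 {λ m → V (2 ℕ.+ m) + - V (1 ℕ.+ m) + V m} {λ _ → 0ℤ}
      (λ m → cong₂ _+_ (cong₂ (λ a b → a + - b) (cycle-periodic Φ₆⁻¹-period (2 ℕ.+ m)) (cycle-periodic Φ₆⁻¹-period (1 ℕ.+ m)))
                       (cycle-periodic Φ₆⁻¹-period m))
      (λ _ → refl) (from-yes (Fin.all? {n = 6} λ i → V (2 ℕ.+ toℕ i) + - V (1 ℕ.+ toℕ i) + V (toℕ i) ℤ.≟ 0ℤ)) m

  data Node : Set where
    g₀ g₁ g₂ g₃ g₄ g₅ g₆ g₇ g₈ : Node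

  next : Node → Node
  next g₀ = g₁
  next g₁ = g₂
  next g₂ = g₃
  next g₃ = g₄
  next g₄ = g₅
  next g₅ = g₆
  next g₆ = g₇
  next g₇ = g₈
  next g₈ = g₁

  -- Stage j describes the series G j = (A - S) / (q^e C), with A = numerator, e = valuation, C = unit, and one step
  --   σ · G j = q^k / (p - q^(k+2) · G (next j)),   σ = -1 if negated and 1 otherwise,
  -- of its H-fraction; after clearing denominators the two sides of this step differ by
  -- certificate · (q S² + (1 - 2q - q³) S - 1).  hankelPeriod lists the Hankel determinants of G j for n < 12.
  record Stage : Set where
    field
      numerator    : List ℤ
      valuation    : ℕ
      unit         : UnitFactor
      negated      : Bool
      k            : ℕ
      p            : Vec ℤ (suc (suc k))
      p₀≡1         : head p ≡ 1ℤ
      certificate  : List ℤ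
      hankelPeriod : Vec ℤ 12

  stage : Node → Stage
  stage g₀ = record
    { numerator = []; valuation = 0; unit = one; negated = true
    ; k = 0; p = 1ℤ ∷ -1ℤ ∷ []; p₀≡1 = refl; certificate = 0ℤ ∷ 1ℤ ∷ []
    ; hankelPeriod = 1ℤ ∷ -1ℤ ∷ -1ℤ ∷ 1ℤ ∷ 1ℤ ∷ 0ℤ ∷ -1ℤ ∷ 0ℤ ∷ 0ℤ ∷ -1ℤ ∷ 0ℤ ∷ 1ℤ ∷ [] }
  stage g₁ = record
    { numerator = 1ℤ ∷ 0ℤ ∷ 1ℤ ∷ []; valuation = 1; unit = one; negated = true
    ; k = 0; p = 1ℤ ∷ 1ℤ ∷ []; p₀≡1 = refl; certificate = 0ℤ ∷ 1ℤ ∷ []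
    ; hankelPeriod = 1ℤ ∷ -1ℤ ∷ -1ℤ ∷ 1ℤ ∷ 0ℤ ∷ -1ℤ ∷ 0ℤ ∷ 0ℤ ∷ 1ℤ ∷ 0ℤ ∷ -1ℤ ∷ 1ℤ ∷ [] }
  stage g₂ = record
    { numerator = 1ℤ ∷ 0ℤ ∷ 1ℤ ∷ []; valuation = 1; unit = Φ₆; negated = true
    ; k = 0; p = 1ℤ ∷ 0ℤ ∷ []; p₀≡1 = refl; certificate = 0ℤ ∷ 1ℤ ∷ []
    ; hankelPeriod = 1ℤ ∷ -1ℤ ∷ -1ℤ ∷ 0ℤ ∷ 1ℤ ∷ 0ℤ ∷ 0ℤ ∷ 1ℤ ∷ 0ℤ ∷ -1ℤ ∷ -1ℤ ∷ 1ℤ ∷ [] }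
  stage g₃ = record
    { numerator = 1ℤ ∷ []; valuation = 1; unit = one; negated = true
    ; k = 0; p = 1ℤ ∷ 0ℤ ∷ []; p₀≡1 = refl; certificate = 0ℤ ∷ 1ℤ ∷ []
    ; hankelPeriod = 1ℤ ∷ -1ℤ ∷ 0ℤ ∷ 1ℤ ∷ 0ℤ ∷ 0ℤ ∷ -1ℤ ∷ 0ℤ ∷ 1ℤ ∷ -1ℤ ∷ -1ℤ ∷ 1ℤ ∷ [] }
  stage g₄ = record
    { numerator = 1ℤ ∷ 1ℤ ∷ 1ℤ ∷ []; valuation = 1; unit = Φ₄; negated = false
    ; k = 1; p = 1ℤ ∷ 0ℤ ∷ + 2 ∷ []; p₀≡1 = refl; certificate = 0ℤ ∷ 0ℤ ∷ -1ℤ ∷ []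
    ; hankelPeriod = 1ℤ ∷ 0ℤ ∷ -1ℤ ∷ 0ℤ ∷ 0ℤ ∷ -1ℤ ∷ 0ℤ ∷ 1ℤ ∷ 1ℤ ∷ -1ℤ ∷ -1ℤ ∷ 1ℤ ∷ [] }
  stage g₅ = record
    { numerator = 1ℤ ∷ 1ℤ ∷ []; valuation = 2; unit = one; negated = true
    ; k = 2; p = 1ℤ ∷ 0ℤ ∷ + 2 ∷ -1ℤ ∷ []; p₀≡1 = refl; certificate = 0ℤ ∷ 0ℤ ∷ 0ℤ ∷ 1ℤ ∷ []
    ; hankelPeriod = 1ℤ ∷ 0ℤ ∷ 0ℤ ∷ 1ℤ ∷ 0ℤ ∷ -1ℤ ∷ -1ℤ ∷ 1ℤ ∷ 1ℤ ∷ -1ℤ ∷ -1ℤ ∷ 0ℤ ∷ [] }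
  stage g₆ = record
    { numerator = 1ℤ ∷ 1ℤ ∷ []; valuation = 3; unit = one; negated = true
    ; k = 1; p = 1ℤ ∷ 0ℤ ∷ + 2 ∷ []; p₀≡1 = refl; certificate = 0ℤ ∷ 0ℤ ∷ 1ℤ ∷ []
    ; hankelPeriod = 1ℤ ∷ 0ℤ ∷ -1ℤ ∷ 1ℤ ∷ 1ℤ ∷ -1ℤ ∷ -1ℤ ∷ 1ℤ ∷ 0ℤ ∷ -1ℤ ∷ 0ℤ ∷ 0ℤ ∷ [] }
  stage g₇ = record
    { numerator = 1ℤ ∷ 1ℤ ∷ 1ℤ ∷ []; valuation = 2; unit = one; negated = false
    ; k = 0; p = 1ℤ ∷ 0ℤ ∷ []; p₀≡1 = refl; certificate = 0ℤ ∷ -1ℤ ∷ []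
    ; hankelPeriod = 1ℤ ∷ 1ℤ ∷ -1ℤ ∷ -1ℤ ∷ 1ℤ ∷ 1ℤ ∷ 0ℤ ∷ -1ℤ ∷ 0ℤ ∷ 0ℤ ∷ -1ℤ ∷ 0ℤ ∷ [] }
  stage g₈ = record
    { numerator = 1ℤ ∷ []; valuation = 1; unit = Φ₄; negated = true
    ; k = 0; p = 1ℤ ∷ 0ℤ ∷ []; p₀≡1 = refl; certificate = 0ℤ ∷ 1ℤ ∷ []
    ; hankelPeriod = 1ℤ ∷ -1ℤ ∷ -1ℤ ∷ 1ℤ ∷ 1ℤ ∷ 0ℤ ∷ -1ℤ ∷ 0ℤ ∷ 0ℤ ∷ -1ℤ ∷ 0ℤ ∷ 1ℤ ∷ [] }

  factor : Node → ℕ → ℤ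
  factor j m = sign negated (suc k ℕ.+ m) * ε k
    where open Stage (stage j)

  shift : Node → ℕ
  shift j = Stage.k (stage j)

  hankelTable : Node → ℕ → ℤ
  hankelTable j = cycle (Stage.hankelPeriod (stage j))

  factor-periodic : ∀ j → Periodic 12 (factor j)
  factor-periodic j =
    Periodic-* {f = λ m → sign negated (suc k ℕ.+ m)} (Periodic-shift (suc k) (sign-periodic negated)) (λ _ → refl)
    where open Stage (stage j)

  module _ (j : Node) where

    RecursionOnPeriod : Set
    RecursionOnPeriod = ∀ (i : Fin 12) → hankelTable j (suc (shift j) ℕ.+ toℕ i) ≡ factor j (toℕ i) * hankelTable (next j) (toℕ i)

    recursionOnPeriod? : Dec RecursionOnPeriod
    recursionOnPeriod? = Fin.all? λ i →
      hankelTable j (suc (shift j) ℕ.+ toℕ i) ℤ.≟ factor j (toℕ i) * hankelTable (next j) (toℕ i)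

    InitialValues : Set
    InitialValues = ∀ (i : Fin (suc (shift j))) → hankelTable j (toℕ i) ≡ δ (toℕ i) 0

    initialValues? : Dec InitialValues
    initialValues? = Fin.all? λ i → hankelTable j (toℕ i) ℤ.≟ δ (toℕ i) 0

  tables-consistent : ∀ j → RecursionOnPeriod j × InitialValues j
  tables-consistent g₀ = from-yes (recursionOnPeriod? g₀ ×-dec initialValues? g₀)
  tables-consistent g₁ = from-yes (recursionOnPeriod? g₁ ×-dec initialValues? g₁)
  tables-consistent g₂ = from-yes (recursionOnPeriod? g₂ ×-dec initialValues? g₂)
  tables-consistent g₃ = from-yes (recursionOnPeriod? g₃ ×-dec initialValues? g₃)
  tables-consistent g₄ = from-yes (recursionOnPeriod? g₄ ×-dec initialValues? g₄)
  tables-consistent g₅ = from-yes (recursionOnPeriod? g₅ ×-dec initialValues? g₅)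
  tables-consistent g₆ = from-yes (recursionOnPeriod? g₆ ×-dec initialValues? g₆)
  tables-consistent g₇ = from-yes (recursionOnPeriod? g₇ ×-dec initialValues? g₇)
  tables-consistent g₈ = from-yes (recursionOnPeriod? g₈ ×-dec initialValues? g₈)

  hankelTable-recursion : SatisfiesRecursion next shift factor hankelTable
  hankelTable-recursion j =
    periodic-ext 11 {λ m → hankelTable j (suc (shift j) ℕ.+ m)} {λ m → factor j m * hankelTable (next j) m}
    (Periodic-shift (suc (shift j)) (cycle-periodic (Stage.hankelPeriod (stage j))))
    (Periodic-* {f = factor j} (factor-periodic j) (cycle-periodic (Stage.hankelPeriod (stage (next j)))))
    (proj₁ (tables-consistent j))

  hankelTable-initial : ∀ j n → n ≤ shift j → hankelTable j n ≡ δ n 0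
  hankelTable-initial j n n≤shift = subst (λ m → hankelTable j m ≡ δ m 0) (Fin.toℕ-fromℕ< (s≤s n≤shift))
    (proj₂ (tables-consistent j) (Fin.fromℕ< (s≤s n≤shift)))

  signᴱ : Bool → ∀ {n} → Polynomial n → Polynomial n
  signᴱ false x = x
  signᴱ true  x = :- x

  numeratorᴱ : Node → ∀ {n} → Polynomial n → Polynomial n → Polynomial n
  numeratorᴱ j x S = polyᴱ (Stage.numerator (stage j)) x :- S

  denominatorᴱ : Node → ∀ {n} → Polynomial n → Polynomial n
  denominatorᴱ j x = x :^ Stage.valuation (stage j) :* unitFactorᴱ (Stage.unit (stage j)) x

  stepLhsᴱ stepRhsᴱ : Node → ∀ {n} → Polynomial n → Polynomial n → Polynomial n
  stepLhsᴱ j x S = (polyᴱ (toList p) x :* denominatorᴱ (next j) x :- x :^ suc (suc k) :* numeratorᴱ (next j) x S)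
                     :* signᴱ negated (numeratorᴱ j x S)
    where open Stage (stage j)
  stepRhsᴱ j x S = denominatorᴱ j x :* denominatorᴱ (next j) x :* x :^ k :+ polyᴱ certificate x :* silverᴱ x S
    where open Stage (stage j)

  shiftedNode : Fin 4 → Node
  shiftedNode Fin.zero                             = g₀
  shiftedNode (Fin.suc Fin.zero)                   = g₃
  shiftedNode (Fin.suc (Fin.suc Fin.zero))         = g₅
  shiftedNode (Fin.suc (Fin.suc (Fin.suc Fin.zero))) = g₆

  module Silver (S : Series) (silverEq : SilverEq S) where

    silverSeries : Series
    silverSeries = ⟦ silverᴱ (var Fin.zero) (var (Fin.suc Fin.zero)) ⟧ (q ∷ S ∷ [])

    silver : silverSeries ≗ 0S
    silver n = begin
      silverSeries n
        ≡⟨ solve 2 (λ q S → silverᴱ q S := q :* (S :* S) :+ (S :- (q :* S :+ (q :* S :+ q :* (q :* (q :* S))))) :- con 1ℤ)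
             R.refl q S n ⟩
      (q ⊛ (S ⊛ S) ⊕ (S ⊖ (q ⊛ S ⊕ (q ⊛ S ⊕ q ⊛ (q ⊛ (q ⊛ S))))) ⊖ constant 1ℤ) n
        ≡⟨ cong (_+ - constant 1ℤ n)
             (cong₂ _+_ qS²≡ (cong (λ z → S n + - z) (cong₂ _+_ (q⊛≗shiftQ S n) (cong₂ _+_ (q⊛≗shiftQ S n) q³S≡)))) ⟩
      (addS (shiftQ (mulS S S)) (addS S (negS (addS (shiftQ S) (addS (shiftQ S) (shiftQ (shiftQ (shiftQ S))))))) ⊖ constant 1ℤ) n
        ≡⟨ cong (_+ - constant 1ℤ n) (silverEq n) ⟩
      oneS n + - constant 1ℤ n
        ≡⟨ one-cancel n ⟩
      0ℤ ∎
      where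
      open ≡-Reasoning
      qS²≡ : (q ⊛ (S ⊛ S)) n ≡ shiftQ (mulS S S) n
      qS²≡ = trans (q⊛≗shiftQ (S ⊛ S) n) (shiftQ-cong (λ m → sym (mulS≗⊛ S S m)) n)
      q³S≡ : (q ⊛ (q ⊛ (q ⊛ S))) n ≡ shiftQ (shiftQ (shiftQ S)) n
      q³S≡ = trans (q⊛≗shiftQ _ n) (shiftQ-cong (λ m → trans (q⊛≗shiftQ _ m) (shiftQ-cong (q⊛≗shiftQ S) m)) n)
      one-cancel : ∀ n → oneS n + - constant 1ℤ n ≡ 0ℤ
      one-cancel zero    = refl
      one-cancel (suc n) = refl

    private
      isolate : ∀ a x b c → a + (x + - b) ≡ c → x ≡ (c + - a) + b
      isolate a x b c eq = trans (ℤ-solve 3 (λ a x b → x ℤ:= ((a ℤ:+ (x ℤ:- b)) ℤ:- a) ℤ:+ b) refl a x b)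
                                 (cong (λ z → (z + - a) + b) eq)
        where open +-*-Solver using () renaming (solve to ℤ-solve; _:=_ to _ℤ:=_; _:+_ to _ℤ:+_; _:-_ to _ℤ:-_)

    S₀ : S 0 ≡ 1ℤ
    S₀ = trans (sym (trans (ℤ.+-identityˡ _) (ℤ.+-identityʳ _))) (silverEq 0)

    S₁ : S 1 ≡ 1ℤ
    S₁ = trans (isolate (S 0 * S 0) (S 1) (S 0 + (S 0 + 0ℤ)) 0ℤ (silverEq 1))
               (cong (λ z → (0ℤ + - (z * z)) + (z + (z + 0ℤ))) S₀)

    S₂ : S 2 ≡ 0ℤ
    S₂ = trans (isolate (S 0 * S 1 + S 1 * S 0) (S 2) (S 1 + (S 1 + 0ℤ)) 0ℤ (silverEq 2))
               (cong₂ (λ z w → (0ℤ + - (z * w + w * z)) + (w + (w + 0ℤ))) S₀ S₁)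

    G : Node → Series
    G j = unshiftQⁿ valuation ((poly numerator ⊖ S) ⊛ unitFactor⁻¹ unit)
      where open Stage (stage j)

    denominator : Node → Series
    denominator j = q ^ valuation ⊛ unitFactor unit
      where open Stage (stage j)

    StepIdentity : Node → Set
    StepIdentity j =
      (poly (toList p) ⊛ denominator (next j) ⊖ q ^ suc (suc k) ⊛ (poly Next.numerator ⊖ S)) ⊛ signed negated (poly numerator ⊖ S)
        ≗ denominator j ⊛ denominator (next j) ⊛ q ^ k ⊕ poly certificate ⊛ silverSeries
      where
      open Stage (stage j)
      module Next = Stage (stage (next j))

    record Certified (j : Node) : Set where
      field
        numerator-low : ∀ (i : Fin (Stage.valuation (stage j))) → (poly (Stage.numerator (stage j)) ⊖ S) (toℕ i) ≡ 0ℤ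
        identity      : StepIdentity j

    private
      vanishes : ∀ {i c} → S i ≡ c → c + - S i ≡ 0ℤ
      vanishes {i} {c} Sᵢ≡c = trans (cong (λ z → c + - z) Sᵢ≡c) (ℤ.+-inverseʳ c)

    certified : ∀ j → Certified j
    certified g₀ = record
      { numerator-low = λ ()
      ; identity      = solve 2 (λ x y → stepLhsᴱ g₀ x y := stepRhsᴱ g₀ x y) R.refl q S }
    certified g₁ = record
      { numerator-low = λ { Fin.zero → vanishes S₀ }
      ; identity      = solve 2 (λ x y → stepLhsᴱ g₁ x y := stepRhsᴱ g₁ x y) R.refl q S }
    certified g₂ = record
      { numerator-low = λ { Fin.zero → vanishes S₀ }
      ; identity      = solve 2 (λ x y → stepLhsᴱ g₂ x y := stepRhsᴱ g₂ x y) R.refl q S }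
    certified g₃ = record
      { numerator-low = λ { Fin.zero → vanishes S₀ }
      ; identity      = solve 2 (λ x y → stepLhsᴱ g₃ x y := stepRhsᴱ g₃ x y) R.refl q S }
    certified g₄ = record
      { numerator-low = λ { Fin.zero → vanishes S₀ }
      ; identity      = solve 2 (λ x y → stepLhsᴱ g₄ x y := stepRhsᴱ g₄ x y) R.refl q S }
    certified g₅ = record
      { numerator-low = λ { Fin.zero → vanishes S₀ ; (Fin.suc Fin.zero) → vanishes S₁ }
      ; identity      = solve 2 (λ x y → stepLhsᴱ g₅ x y := stepRhsᴱ g₅ x y) R.refl q S }
    certified g₆ = record
      { numerator-low = λ { Fin.zero → vanishes S₀ ; (Fin.suc Fin.zero) → vanishes S₁
                          ; (Fin.suc (Fin.suc Fin.zero)) → vanishes S₂ }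
      ; identity      = solve 2 (λ x y → stepLhsᴱ g₆ x y := stepRhsᴱ g₆ x y) R.refl q S }
    certified g₇ = record
      { numerator-low = λ { Fin.zero → vanishes S₀ ; (Fin.suc Fin.zero) → vanishes S₁ }
      ; identity      = solve 2 (λ x y → stepLhsᴱ g₇ x y := stepRhsᴱ g₇ x y) R.refl q S }
    certified g₈ = record
      { numerator-low = λ { Fin.zero → vanishes S₀ }
      ; identity      = solve 2 (λ x y → stepLhsᴱ g₈ x y := stepRhsᴱ g₈ x y) R.refl q S }

    quotient : ∀ j → Quotient (G j) (poly (Stage.numerator (stage j)) ⊖ S)
    quotient j = division {poly numerator ⊖ S} {unitFactor unit} {unitFactor⁻¹ unit} valuation (unitFactor-inverse unit) λ i i<e →
      subst (λ m → (poly numerator ⊖ S) m ≡ 0ℤ) (Fin.toℕ-fromℕ< i<e) (Certified.numerator-low (certified j) (Fin.fromℕ< i<e))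
      where open Stage (stage j)

    modulo-silver : ∀ {X Y r} → X ≗ Y ⊕ r ⊛ silverSeries → X ≗ Y
    modulo-silver {X} {Y} {r} X≗Y+r·silver = R.trans X≗Y+r·silver
      (R.trans (R.+-congˡ {Y} (R.trans (R.*-congˡ {r} silver) (R.zeroʳ r))) (R.+-identityʳ Y))

    step : ∀ j → HFraction (signed (Stage.negated (stage j)) (G j)) (G (next j))
    step j = record
      { k = k ; p = p ; p₀≡1 = p₀≡1
      ; equation = clear-denominators {P = poly (toList p)} {Q = q ^ suc (suc k)} {Qk = q ^ k}
                     (signed-quotient negated (quotient j)) (quotient (next j))
                     (modulo-silver {r = poly certificate} (Certified.identity (certified j)))
      }
      where open Stage (stage j)

    hankelDet : Node → ℕ → ℤ
    hankelDet j n = det′ n (hankelMatrix (G j))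

    hankelDet-recursion : SatisfiesRecursion next shift factor hankelDet
    hankelDet-recursion j m = begin
      hankelDet j N                                             ≡⟨ det′-unsigned negated N (G j) ⟩
      sign negated N * det′ N (hankelMatrix (signed negated (G j)))
        ≡⟨ cong (sign negated N *_) (hfraction-hankel-shift (step j) m) ⟩
      sign negated N * (ε k * hankelDet (next j) m)             ≡⟨ sym (ℤ.*-assoc (sign negated N) (ε k) _) ⟩
      factor j m * hankelDet (next j) m ∎
      where
      open ≡-Reasoning
      open Stage (stage j)
      N = suc k ℕ.+ m

    hankelDet-initial : ∀ j n → n ≤ shift j → hankelDet j n ≡ δ n 0
    hankelDet-initial j zero    _       = refl
    hankelDet-initial j (suc n) sn≤k = begin
      hankelDet j (suc n)                                                     ≡⟨ det′-unsigned negated (suc n) (G j) ⟩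
      sign negated (suc n) * det′ (suc n) (hankelMatrix (signed negated (G j)))
        ≡⟨ cong (sign negated (suc n) *_) (hfraction-hankel-vanishes (step j) n sn≤k) ⟩
      sign negated (suc n) * 0ℤ                                       ≡⟨ ℤ.*-zeroʳ (sign negated (suc n)) ⟩
      0ℤ ∎
      where
      open ≡-Reasoning
      open Stage (stage j)

    hankelDet≡hankelTable : ∀ n j → hankelDet j n ≡ hankelTable j n
    hankelDet≡hankelTable = recursion-unique next shift factor hankelDet-recursion hankelTable-recursion
      λ j n n≤shift → trans (hankelDet-initial j n n≤shift) (sym (hankelTable-initial j n n≤shift))

    unshiftQⁿ-silver : ∀ A e → length A ≤ e → ∀ x → unshiftQⁿ e ((poly A ⊖ S) ⊛ oneS) x ≡ - S (e ℕ.+ x)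
    unshiftQⁿ-silver A e len≤e x = begin
      ((poly A ⊖ S) ⊛ oneS) (e ℕ.+ x)       ≡⟨ R.*-identityʳ (poly A ⊖ S) (e ℕ.+ x) ⟩
      poly A (e ℕ.+ x) + - S (e ℕ.+ x)       ≡⟨ cong (_+ - S (e ℕ.+ x)) (poly-degree A (ℕ.≤-trans len≤e (ℕ.m≤m+n e x))) ⟩
      0ℤ + - S (e ℕ.+ x)                     ≡⟨ ℤ.+-identityˡ _ ⟩
      - S (e ℕ.+ x) ∎
      where open ≡-Reasoning

    S-tail : ∀ ℓ x → S (toℕ ℓ ℕ.+ x) ≡ - G (shiftedNode ℓ) x
    S-tail ℓ x = trans (sym (ℤ.neg-involutive _)) (cong -_ (sym (tail ℓ)))
      where
      tail : ∀ ℓ → G (shiftedNode ℓ) x ≡ - S (toℕ ℓ ℕ.+ x)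
      tail Fin.zero                            = unshiftQⁿ-silver [] 0 z≤n x
      tail (Fin.suc Fin.zero)                  = unshiftQⁿ-silver (1ℤ ∷ []) 1 ℕ.≤-refl x
      tail (Fin.suc (Fin.suc Fin.zero))        = unshiftQⁿ-silver (1ℤ ∷ 1ℤ ∷ []) 2 ℕ.≤-refl x
      tail (Fin.suc (Fin.suc (Fin.suc Fin.zero))) = unshiftQⁿ-silver (1ℤ ∷ 1ℤ ∷ []) 3 (ℕ.n≤1+n 2) x

    hankel-S : ∀ ℓ n → hankel S (toℕ ℓ) n ≡ signPow n * hankelTable (shiftedNode ℓ) n
    hankel-S ℓ n = begin
      det n (λ i j → S (toℕ ℓ ℕ.+ toℕ i ℕ.+ toℕ j))  ≡⟨ det≡det′ n (λ a b → S (toℕ ℓ ℕ.+ a ℕ.+ b)) ⟩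
      det′ n (λ a b → S (toℕ ℓ ℕ.+ a ℕ.+ b))
        ≡⟨ det′-cong-≗ n (λ a b → trans (cong S (ℕ.+-assoc (toℕ ℓ) a b)) (S-tail ℓ (a ℕ.+ b))) ⟩
      det′ n (λ a b → - G (shiftedNode ℓ) (a ℕ.+ b))  ≡⟨ det′-neg n (hankelMatrix (G (shiftedNode ℓ))) ⟩
      signPow n * hankelDet (shiftedNode ℓ) n         ≡⟨ cong (signPow n *_) (hankelDet≡hankelTable n (shiftedNode ℓ)) ⟩
      signPow n * hankelTable (shiftedNode ℓ) n ∎
      where open ≡-Reasoning

open SilverSeries

-- From here on _+_ is addition on ℕ, as in the statement; the sections above use it for ℤ.
open import Data.Nat using (_+_)

isSign? : ∀ x → Dec (IsSign x)
isSign? x = x ℤ.≟ -1ℤ ⊎-dec (x ℤ.≟ 0ℤ ⊎-dec x ℤ.≟ 1ℤ)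

table-signs : ∀ ℓ (i : Fin 12) → IsSign (lookup (table ℓ) i)
table-signs = from-yes (Fin.all? λ ℓ → Fin.all? {n = 12} λ i → isSign? (lookup (table ℓ) i))

table-matches : ∀ ℓ n → signPow n * hankelTable (shiftedNode ℓ) n ≡ cycle (table ℓ) n
table-matches ℓ = periodic-ext 11 {λ n → signPow n * hankelTable (shiftedNode ℓ) n}
  (Periodic-* {12} {signPow} (sign-periodic true) (cycle-periodic (Stage.hankelPeriod (stage (shiftedNode ℓ)))))
  (cycle-periodic (table ℓ))
  (from-yes (Fin.all? {n = 4} λ ℓ → Fin.all? {n = 12} λ i →
    signPow (toℕ i) * hankelTable (shiftedNode ℓ) (toℕ i) ℤ.≟ cycle (table ℓ) (toℕ i)) ℓ)

table-relation : ∀ (ℓ : Fin 3) n → cycle (table (Fin.suc ℓ)) n ≡ signPow (n + 1) * cycle (table (inject₁ ℓ)) (n + 3)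
table-relation ℓ = periodic-ext 11 (cycle-periodic (table (Fin.suc ℓ)))
  (Periodic-* {12} {λ n → signPow (n + 1)} (λ n → sign-periodic true (n + 1)) (λ n → cycle-periodic (table (inject₁ ℓ)) (n + 3)))
  (from-yes (Fin.all? {n = 3} λ ℓ → Fin.all? {n = 12} λ i →
    cycle (table (Fin.suc ℓ)) (toℕ i) ℤ.≟ signPow (toℕ i + 1) * cycle (table (inject₁ ℓ)) (toℕ i + 3)) ℓ)

theorem1p8 : (S : Series) → SilverEq S →
    ((ℓ : Fin 4) →
        ((n : ℕ) → hankel S (toℕ ℓ) (n + 12) ≡ hankel S (toℕ ℓ) n)
      × ((n : ℕ) → IsSign (hankel S (toℕ ℓ) n))
      × ((k : Fin 12) → hankel S (toℕ ℓ) (toℕ k) ≡ lookup (table ℓ) k))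
    × ((ℓ : ℕ) → ℓ ≤ 2 → (n : ℕ) →
        hankel S (ℓ + 1) n ≡ signPow (n + 1) * hankel S ℓ (n + 3))
theorem1p8 S silverEq = (λ ℓ → periodicity ℓ , signs ℓ , values ℓ) , relation
  where
  open Silver S silverEq using (hankel-S)
  Δ≡table : ∀ ℓ n → hankel S (toℕ ℓ) n ≡ cycle (table ℓ) n
  Δ≡table ℓ n = trans (hankel-S ℓ n) (table-matches ℓ n)
  periodicity : ∀ ℓ n → hankel S (toℕ ℓ) (n + 12) ≡ hankel S (toℕ ℓ) n
  periodicity ℓ n = trans (Δ≡table ℓ (n + 12)) (trans (cong (cycle (table ℓ)) (ℕ.+-comm n 12))
                      (trans (cycle-periodic (table ℓ) n) (sym (Δ≡table ℓ n))))
  signs : ∀ ℓ n → IsSign (hankel S (toℕ ℓ) n)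
  signs ℓ n = subst IsSign (sym (Δ≡table ℓ n)) (table-signs ℓ (n mod 12))
  values : ∀ ℓ (k : Fin 12) → hankel S (toℕ ℓ) (toℕ k) ≡ lookup (table ℓ) k
  values ℓ k = trans (Δ≡table ℓ (toℕ k)) (cycle-lookup (table ℓ) k)
  relation-at : ∀ (ℓ : Fin 3) n → hankel S (suc (toℕ ℓ)) n ≡ signPow (n + 1) * hankel S (toℕ (inject₁ ℓ)) (n + 3)
  relation-at ℓ n = trans (Δ≡table (Fin.suc ℓ) n) (trans (table-relation ℓ n)
                      (cong (signPow (n + 1) *_) (sym (Δ≡table (inject₁ ℓ) (n + 3)))))
  relation : (ℓ : ℕ) → ℓ ≤ 2 → (n : ℕ) → hankel S (ℓ + 1) n ≡ signPow (n + 1) * hankel S ℓ (n + 3)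
  relation 0 _ = relation-at Fin.zero
  relation 1 _ = relation-at (Fin.suc Fin.zero)
  relation 2 _ = relation-at (Fin.suc (Fin.suc Fin.zero))
  relation (suc (suc (suc _))) (s≤s (s≤s ()))
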